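{- For every $d\geq 1$, the logic $\mathsf{C}^{(0,d+1)}$ identifies every colored graph of tree-depth at most $d$; that is, for every colored graph $G$ with $\operatorname{td}(G)\leq d$ and every colored graph $H$ not isomorphic to $G$, there is a sentence of $\mathsf{C}^{(0,d+1)}$ that holds in exactly one of $G$ and $H$.
   Context: Colored graphs are finite simple graphs with a vertex coloring; isomorphisms preserve edges, non-edges and colors. First-order logic with counting $\mathsf{C}$ has atomic formulas $x=y$, $E(x,y)$, $U_c(x)$, Boolean connectives, and quantifiers $\forall,\exists,\exists^{\geq n}$ ($n\in\mathbb{N}$). A variable $x$ is requantified in $\varphi$ if it is both free and bound in $\varphi$, or $\varphi$ has a subformula $Qx\,\psi$ where $\psi$ has a subformula $Q'x\,\chi$ ($Q,Q'$ quantifiers). $\mathsf{C}^{(0,k)}$ is the set of $\mathsf{C}$-formulas with variables in $\{y_1,\dots,y_k\}$ in which no variable is requantified. Tree-depth: if $G_1,\dots,G_p$ are the connected components of $G$, then $\operatorname{td}(G)=1$ if $|V(G)|=1$; $\operatorname{td}(G)=1+\min_{v\in V(G)}\operatorname{td}(G-v)$ if $p=1$ and $|V(G)|>1$; and $\operatorname{td}(G)=\max_{i\in[p]}\operatorname{td}(G_i)$ otherwise. -}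

module Defs where

open import Data.Nat using (ℕ; zero; suc; _+_; _≤_; _<_; _≤ᵇ_)
open import Data.Fin using (Fin; _≟_)
import Data.Fin as F
open import Data.Bool using (Bool; true; false; _∧_; _∨_; not; if_then_else_)
open import Data.Maybe using (Maybe; just; nothing)
open import Data.Product using (Σ; _×_; _,_)
open import Data.Sum using (_⊎_)
open import Relation.Nullary using (¬_; does)
open import Relation.Binary.PropositionalEquality using (_≡_)
open import Function.Bundles using (_↔_; Inverse)

record ColGraph : Set where
  field
    n      : ℕ
    adj    : Fin n → Fin n → Bool
    sym    : ∀ u v → adj u v ≡ adj v u
    irrefl : ∀ v → adj v v ≡ false
    col    : Fin n → ℕ
open ColGraph public

record Iso (G H : ColGraph) : Set where
  field
    bij      : Fin (n G) ↔ Fin (n H)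
    pres-adj : ∀ u v → adj H (Inverse.to bij u) (Inverse.to bij v) ≡ adj G u v
    pres-col : ∀ v → col H (Inverse.to bij v) ≡ col G v

count : ∀ {n} → (Fin n → Bool) → ℕ
count {zero}  f = 0
count {suc n} f = (if f F.zero then 1 else 0) + count (λ i → f (F.suc i))

module _ (G : ColGraph) where

  Vset : Set
  Vset = Fin (n G) → Bool

  _∈_ : Fin (n G) → Vset → Set
  v ∈ S = S v ≡ true

  _⊆_ : Vset → Vset → Set
  A ⊆ B = ∀ v → v ∈ A → v ∈ B

  size : Vset → ℕ
  size S = count S

  remove : Vset → Fin (n G) → Vset
  remove S v w = S w ∧ not (does (w ≟ v))

  data Reach (S : Vset) : Fin (n G) → Fin (n G) → Set where
    here : ∀ {u} → u ∈ S → Reach S u u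
    step : ∀ {u v w} → Reach S u v → w ∈ S → adj G v w ≡ true → Reach S u w

  Connected : Vset → Set
  Connected S = Σ (Fin (n G)) (λ v → v ∈ S) × (∀ u w → u ∈ S → w ∈ S → Reach S u w)

  IsComponent : Vset → Vset → Set
  IsComponent S C = C ⊆ S × Connected C
                    × (∀ u w → u ∈ C → w ∈ S → adj G u w ≡ true → w ∈ C)

  -- TdLe S d  ⇔  td(G[S]) ≤ d, following the recursive definition:
  --  * |V| = 1: td = 1;
  --  * connected, |V| > 1: td = 1 + min_v td(G - v);
  --  * otherwise (p ≠ 1 components): td = max_i td(G_i)  (max ∅ = 0).
  data TdLe : Vset → ℕ → Set where
    single : ∀ {S d} → size S ≡ 1 → 1 ≤ d → TdLe S d
    conn   : ∀ {S d} → Connected S → 1 < size S →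
             (v : Fin (n G)) → v ∈ S → TdLe (remove S v) d → TdLe S (suc d)
    disc   : ∀ {S d} → ¬ Connected S →
             (∀ C → IsComponent S C → TdLe C d) → TdLe S d

full : (G : ColGraph) → Vset G
full G v = true

TreeDepth≤ : ColGraph → ℕ → Set
TreeDepth≤ G d = TdLe G (full G) d

data Quant : Set where
  ∀q ∃q : Quant
  ∃≥    : ℕ → Quant

data Formula (k : ℕ) : Set where
  eq    : Fin k → Fin k → Formula k
  edge  : Fin k → Fin k → Formula k
  color : ℕ → Fin k → Formula k
  neg   : Formula k → Formula k
  and   : Formula k → Formula k → Formula k
  or    : Formula k → Formula k → Formula k
  quant : Quant → Fin k → Formula k → Formula k

module _ {k : ℕ} where

  isFree : Fin k → Formula k → Bool
  isFree x (eq y z)      = does (x ≟ y) ∨ does (x ≟ z)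
  isFree x (edge y z)    = does (x ≟ y) ∨ does (x ≟ z)
  isFree x (color c y)   = does (x ≟ y)
  isFree x (neg φ)       = isFree x φ
  isFree x (and φ ψ)     = isFree x φ ∨ isFree x ψ
  isFree x (or φ ψ)      = isFree x φ ∨ isFree x ψ
  isFree x (quant Q y φ) = not (does (x ≟ y)) ∧ isFree x φ

  isBound : Fin k → Formula k → Bool
  isBound x (eq y z)      = false
  isBound x (edge y z)    = false
  isBound x (color c y)   = false
  isBound x (neg φ)       = isBound x φ
  isBound x (and φ ψ)     = isBound x φ ∨ isBound x ψ
  isBound x (or φ ψ)      = isBound x φ ∨ isBound x ψ
  isBound x (quant Q y φ) = does (x ≟ y) ∨ isBound x φ

  data Sub : Formula k → Formula k → Set where
    sub-refl : ∀ {φ} → Sub φ φ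
    sub-neg  : ∀ {ψ φ} → Sub ψ φ → Sub ψ (neg φ)
    sub-andˡ : ∀ {ψ φ χ} → Sub ψ φ → Sub ψ (and φ χ)
    sub-andʳ : ∀ {ψ φ χ} → Sub ψ χ → Sub ψ (and φ χ)
    sub-orˡ  : ∀ {ψ φ χ} → Sub ψ φ → Sub ψ (or φ χ)
    sub-orʳ  : ∀ {ψ φ χ} → Sub ψ χ → Sub ψ (or φ χ)
    sub-q    : ∀ {ψ Q y φ} → Sub ψ φ → Sub ψ (quant Q y φ)

  Requantified : Fin k → Formula k → Set
  Requantified x φ =
    (isFree x φ ≡ true × isBound x φ ≡ true)
    ⊎ Σ Quant (λ Q → Σ (Formula k) (λ ψ →
        Sub (quant Q x ψ) φ × isBound x ψ ≡ true))

  Sentence : Formula k → Set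
  Sentence φ = ∀ x → isFree x φ ≡ false

InC0 : (k : ℕ) → Formula k → Set
InC0 k φ = ∀ x → ¬ Requantified x φ

-- Semantics (partial assignments, so empty graphs are handled).

module _ (G : ColGraph) {k : ℕ} where

  Assign : Set
  Assign = Fin k → Maybe (Fin (n G))

  update : Assign → Fin k → Fin (n G) → Assign
  update a x v y = if does (y ≟ x) then just v else a y

  eval : Formula k → Assign → Bool
  eval (eq x y) a with a x | a y
  ... | just u | just v = does (u ≟ v)
  ... | _      | _      = false
  eval (edge x y) a with a x | a y
  ... | just u | just v = adj G u v
  ... | _      | _      = false
  eval (color c x) a with a x
  ... | just u  = does (Data.Nat._≟_ (col G u) c)
  ... | nothing = false
  eval (neg φ) a   = not (eval φ a)
  eval (and φ ψ) a = eval φ a ∧ eval ψ a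
  eval (or φ ψ) a  = eval φ a ∨ eval ψ a
  eval (quant ∀q x φ) a     = count (λ v → eval φ (update a x v)) Data.Nat.≡ᵇ n G
  eval (quant ∃q x φ) a     = 1 ≤ᵇ count (λ v → eval φ (update a x v))
  eval (quant (∃≥ m) x φ) a = m ≤ᵇ count (λ v → eval φ (update a x v))

_⊨_ : ∀ {k} → ColGraph → Formula k → Set
G ⊨ φ = eval G φ (λ _ → nothing) ≡ true

module Submission where

-- A graph of tree-depth at most d has an elimination forest of height at most d: deleting a
-- suitable root from each connected component lowers the tree-depth of what remains. Along a chain
-- of roots ā one builds a counting formula χ(ā), with one free variable per root, that records for
-- every component C hanging below ā how many vertices y have the atomic type of the root of C over
-- ā and satisfy χ(ā y), together with the number of neighbours of the last root (which rules out
-- surplus components). A tuple z̄ of any graph satisfies χ(ā) iff the part hanging below z̄ is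
-- isomorphic over the tuples to the part hanging below ā: one direction transports the counts
-- along the isomorphism, the other matches components one at a time, the root of each component
-- of G finding a partner of the same type. The quantifier depth of χ is at most d + 1, and binding
-- y_i by every quantifier at nesting depth i makes it a C^(0,d+1) formula; for the empty chain it
-- is a sentence that holds in G and in no graph not isomorphic to G.

open import Defs hiding (_∈_; _⊆_) renaming (sym to adj-sym; eq to eqᶠ)
open import Data.Nat using (ℕ; zero; suc; _+_; _≤_; _<_; z≤n; s≤s; _≤ᵇ_; _⊔_; NonZero)
import Data.Nat as ℕ
open import Data.Nat.DivMod using (_mod_; m<n⇒m%n≡m; m%n<n)
open import Data.Nat.Properties
  using (≤-trans; ≤-refl; ≤-reflexive; ≤-antisym; ≤-pred; n≤0⇒n≡0; ≤∧≢⇒<; n≤1+n; n<1+n; n≮n;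
         <-irrefl; ≮⇒≥;
         m≤m+n; m≤m⊔n; m≤n⊔m; ⊔-lub; +-suc; +-monoˡ-≤; +-monoʳ-≤; +-cancelˡ-≡; suc-injective;
         ≤ᵇ⇒≤; ≤⇒≤ᵇ; ≡ᵇ⇒≡; module ≤-Reasoning)
open import Data.Fin using (Fin; _≟_; toℕ) renaming (zero to fz; suc to fs)
open import Data.Fin.Properties using (toℕ-fromℕ<; toℕ-injective; any?)
open import Data.Bool using (Bool; true; false; _∧_; _∨_; not; if_then_else_; T) renaming (_≟_ to _≟ᵇ_)
open import Data.Bool.Properties
  using (T?; T-≡; ⇔→≡; ∧-comm; ∧-assoc; ∧-identityʳ; ∧-zeroʳ; not-injective; not-¬; ¬-not)
open import Data.Vec.Functional using (Vector; []; _∷_; tail)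
open import Data.Product using (Σ; ∃; _×_; _,_; proj₁; proj₂)
open import Data.Maybe using (just; nothing)
open import Data.Sum using (_⊎_; inj₁; inj₂)
open import Data.Empty using (⊥; ⊥-elim)
open import Function.Base using (case_of_)
open import Function.Bundles using (Equivalence; mk⇔; _⇔_; mk↔ₛ′)
open import Relation.Nullary using (¬_; Dec; yes; no; does)
open import Relation.Nullary.Decidable using (dec-true; dec-false)
open import Relation.Binary.PropositionalEquality
open import Axiom.UniquenessOfIdentityProofs using (module Decidable⇒UIP)

∧-intro : ∀ {a b} → a ≡ true → b ≡ true → a ∧ b ≡ true
∧-intro refl refl = refl

∧-elimˡ : ∀ a {b} → a ∧ b ≡ true → a ≡ true
∧-elimˡ true _ = refl

∧-elimʳ : ∀ a {b} → a ∧ b ≡ true → b ≡ true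
∧-elimʳ true e = e

∨-introˡ : ∀ {a} b → a ≡ true → a ∨ b ≡ true
∨-introˡ b refl = refl

∨-introʳ : ∀ a {b} → b ≡ true → a ∨ b ≡ true
∨-introʳ true _ = refl
∨-introʳ false e = e

∨-elim : ∀ a {b} → a ∨ b ≡ true → a ≡ true ⊎ b ≡ true
∨-elim true _ = inj₁ refl
∨-elim false e = inj₂ e

true-iff : ∀ {a b} → (a ≡ true → b ≡ true) → (b ≡ true → a ≡ true) → a ≡ b
true-iff to from = ⇔→≡ (mk⇔ to from)

T⇒≡true : ∀ {b} → T b → b ≡ true
T⇒≡true = Equivalence.to T-≡

≡true⇒T : ∀ {b} → b ≡ true → T b
≡true⇒T = Equivalence.from T-≡

dec-true⁻¹ : ∀ {A : Set} (a? : Dec A) → does a? ≡ true → A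
dec-true⁻¹ (yes a) _ = a

≟-refl : ∀ {n} (x : Fin n) → does (x ≟ x) ≡ true
≟-refl x = dec-true (x ≟ x) refl

anyᵇ : ∀ {n} → (Fin n → Bool) → Bool
anyᵇ {zero}  p = false
anyᵇ {suc n} p = p fz ∨ anyᵇ (λ i → p (fs i))

allᵇ : ∀ {n} → (Fin n → Bool) → Bool
allᵇ {zero}  p = true
allᵇ {suc n} p = p fz ∧ allᵇ (λ i → p (fs i))

anyᵇ-intro : ∀ {n} (p : Fin n → Bool) i → p i ≡ true → anyᵇ p ≡ true
anyᵇ-intro p fz     e = ∨-introˡ _ e
anyᵇ-intro p (fs i) e = ∨-introʳ (p fz) (anyᵇ-intro (λ i → p (fs i)) i e)

anyᵇ-elim : ∀ {n} (p : Fin n → Bool) → anyᵇ p ≡ true → ∃ λ i → p i ≡ true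
anyᵇ-elim {suc n} p e with ∨-elim (p fz) e
... | inj₁ e₀ = fz , e₀
... | inj₂ eₛ with anyᵇ-elim (λ i → p (fs i)) eₛ
...   | i , eᵢ = fs i , eᵢ

allᵇ-intro : ∀ {n} (p : Fin n → Bool) → (∀ i → p i ≡ true) → allᵇ p ≡ true
allᵇ-intro {zero}  p h = refl
allᵇ-intro {suc n} p h = ∧-intro (h fz) (allᵇ-intro (λ i → p (fs i)) (λ i → h (fs i)))

allᵇ-elim : ∀ {n} (p : Fin n → Bool) → allᵇ p ≡ true → ∀ i → p i ≡ true
allᵇ-elim p e fz     = ∧-elimˡ (p fz) e
allᵇ-elim p e (fs i) = allᵇ-elim (λ i → p (fs i)) (∧-elimʳ (p fz) e) i

_⊆_ : ∀ {n} → (Fin n → Bool) → (Fin n → Bool) → Set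
A ⊆ B = ∀ v → A v ≡ true → B v ≡ true

_≐_ : ∀ {n} → (Fin n → Bool) → (Fin n → Bool) → Set
A ≐ B = ∀ v → A v ≡ B v

without : ∀ {n} → (Fin n → Bool) → Fin n → Fin n → Bool
without S v w = S w ∧ not (does (w ≟ v))

count-cong : ∀ {n} {p q : Fin n → Bool} → (∀ i → p i ≡ q i) → count p ≡ count q
count-cong {zero}  h = refl
count-cong {suc n} h rewrite h fz = cong (_ +_) (count-cong (λ i → h (fs i)))

count-true : ∀ n → count {n} (λ _ → true) ≡ n
count-true zero    = refl
count-true (suc n) = cong suc (count-true n)

count-false : ∀ {n} (p : Fin n → Bool) → (∀ i → p i ≡ false) → count p ≡ 0
count-false {zero}  p h = refl
count-false {suc n} p h rewrite h fz = count-false (λ i → p (fs i)) (λ i → h (fs i))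

count≡0⇒false : ∀ {n} (p : Fin n → Bool) → count p ≡ 0 → ∀ i → p i ≡ false
count≡0⇒false p e fz     with p fz
... | false = refl
count≡0⇒false p e (fs i) with p fz
... | false = count≡0⇒false (λ i → p (fs i)) e i

count-≤ : ∀ {n} (p : Fin n → Bool) → count p ≤ n
count-≤ {zero}  p = z≤n
count-≤ {suc n} p with p fz
... | true  = s≤s (count-≤ (λ i → p (fs i)))
... | false = ≤-trans (count-≤ (λ i → p (fs i))) (n≤1+n n)

count>0⇒∃ : ∀ {n} (p : Fin n → Bool) → 1 ≤ count p → ∃ λ i → p i ≡ true
count>0⇒∃ {suc n} p h with p fz in e
... | true  = fz , e
... | false with count>0⇒∃ (λ i → p (fs i)) h
...   | i , eᵢ = fs i , eᵢ

count-without : ∀ {n} (p : Fin n → Bool) v → p v ≡ true → count p ≡ suc (count (without p v))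
count-without p fz e rewrite e = cong suc (count-cong λ i → sym (∧-identityʳ (p (fs i))))
count-without p (fs v) e with p fz
... | true  = cong suc (count-without (λ i → p (fs i)) v e)
... | false = count-without (λ i → p (fs i)) v e

count≡1-unique : ∀ {n} (S : Fin n → Bool) {a b} → count S ≡ 1 → S a ≡ true → S b ≡ true → a ≡ b
count≡1-unique S {a} {b} |S|≡1 sa sb with b ≟ a
... | yes b≡a = sym b≡a
... | no b≢a = ⊥-elim (not-¬ (∧-intro sb (cong not (dec-false (b ≟ a) b≢a)))
                 (count≡0⇒false (without S a) (suc-injective (trans (sym (count-without S a sa)) |S|≡1)) b))

count-partition : ∀ {n} (p c : Fin n → Bool) →
  count p ≡ count (λ w → p w ∧ c w) + count (λ w → p w ∧ not (c w))
count-partition {zero}  p c = refl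
count-partition {suc n} p c with p fz | c fz | count-partition (λ i → p (fs i)) (λ i → c (fs i))
... | true  | true  | ih = cong suc ih
... | true  | false | ih = trans (cong suc ih) (sym (+-suc _ _))
... | false | true  | ih = ih
... | false | false | ih = ih

exactly⇒≡ : ∀ c N → ((c ≤ᵇ N) ∧ not (suc c ≤ᵇ N)) ≡ true → N ≡ c
exactly⇒≡ c N e = ≤-antisym N≤c (≤ᵇ⇒≤ c N (≡true⇒T (∧-elimˡ (c ≤ᵇ N) e)))
  where
  N≤c : N ≤ c
  N≤c = ≮⇒≥ λ c<N → not-¬ (T⇒≡true (≤⇒≤ᵇ c<N)) (not-injective (∧-elimʳ (c ≤ᵇ N) e))

exactly-refl : ∀ c → ((c ≤ᵇ c) ∧ not (suc c ≤ᵇ c)) ≡ true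
exactly-refl c = ∧-intro (T⇒≡true (≤⇒≤ᵇ (≤-refl {c})))
                         (cong not (¬-not λ e → n≮n c (≤ᵇ⇒≤ (suc c) c (≡true⇒T e))))

count-∧-⊆ : ∀ {n} (S p : Fin n → Bool) → p ⊆ S → count (λ y → S y ∧ p y) ≡ count p
count-∧-⊆ S p p⊆S = count-cong λ y → true-iff (∧-elimʳ (S y)) (λ e → ∧-intro (p⊆S y e) e)

count-split-⊆ : ∀ {n} (S C p : Fin n → Bool) → C ⊆ S →
  count (λ y → S y ∧ p y) ≡ count (λ y → C y ∧ p y) + count (λ y → (S y ∧ not (C y)) ∧ p y)
count-split-⊆ S C p C⊆S = trans (count-partition (λ y → S y ∧ p y) C)
                                (cong₂ _+_ (count-cong inside) (count-cong outside))
  where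
  inside : ∀ y → ((S y ∧ p y) ∧ C y) ≡ (C y ∧ p y)
  inside y with C y in e
  ... | true  rewrite C⊆S y e = ∧-identityʳ (p y)
  ... | false = ∧-zeroʳ (S y ∧ p y)
  outside : ∀ y → ((S y ∧ p y) ∧ not (C y)) ≡ ((S y ∧ not (C y)) ∧ p y)
  outside y = begin
    (S y ∧ p y) ∧ not (C y)   ≡⟨ ∧-assoc (S y) (p y) (not (C y)) ⟩
    S y ∧ (p y ∧ not (C y))   ≡⟨ cong (S y ∧_) (∧-comm (p y) (not (C y))) ⟩
    S y ∧ (not (C y) ∧ p y)   ≡⟨ ∧-assoc (S y) (not (C y)) (p y) ⟨
    (S y ∧ not (C y)) ∧ p y   ∎
    where open ≡-Reasoning

count-minus-cancel : ∀ {n m} (S C p : Fin n → Bool) (T C′ q : Fin m → Bool) → C ⊆ S → C′ ⊆ T →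
  count (λ y → S y ∧ p y) ≡ count (λ y → T y ∧ q y) →
  count (λ y → C y ∧ p y) ≡ count (λ y → C′ y ∧ q y) →
  count (λ y → (S y ∧ not (C y)) ∧ p y) ≡ count (λ y → (T y ∧ not (C′ y)) ∧ q y)
count-minus-cancel S C p T C′ q C⊆S C′⊆T S≡T C≡C′ = +-cancelˡ-≡ (count (λ y → C y ∧ p y)) _ _ (begin
  count (λ y → C y ∧ p y) + count (λ y → (S y ∧ not (C y)) ∧ p y)     ≡⟨ count-split-⊆ S C p C⊆S ⟨
  count (λ y → S y ∧ p y)                                             ≡⟨ S≡T ⟩
  count (λ y → T y ∧ q y)                                             ≡⟨ count-split-⊆ T C′ q C′⊆T ⟩
  count (λ y → C′ y ∧ q y) + count (λ y → (T y ∧ not (C′ y)) ∧ q y)   ≡⟨ cong (_+ _) C≡C′ ⟨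
  count (λ y → C y ∧ p y) + count (λ y → (T y ∧ not (C′ y)) ∧ q y)   ∎)
  where open ≡-Reasoning

count-minus-< : ∀ {n} (S C : Fin n → Bool) v → S v ≡ true → C v ≡ true →
  count (λ w → S w ∧ not (C w)) < count S
count-minus-< S C v sv cv = begin-strict
  count (λ w → S w ∧ not (C w))                                  <⟨ n<1+n _ ⟩
  suc (count (λ w → S w ∧ not (C w)))                            ≤⟨ +-monoˡ-≤ _ 1≤|S∩C| ⟩
  count (λ w → S w ∧ C w) + count (λ w → S w ∧ not (C w))        ≡⟨ count-partition S C ⟨
  count S                                                        ∎
  where
  open ≤-Reasoning
  1≤|S∩C| : 1 ≤ count (λ w → S w ∧ C w)
  1≤|S∩C| = subst (1 ≤_) (sym (count-without _ v (∧-intro sv cv))) (s≤s z≤n)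

split-⊆ : ∀ {n} (S C : Fin n → Bool) → C ⊆ S → (λ v → C v ∨ (S v ∧ not (C v))) ≐ S
split-⊆ S C C⊆S v with C v in e
... | true  = sym (C⊆S v e)
... | false = ∧-identityʳ (S v)

record PartialBijection {n m} (P : Fin n → Bool) (Q : Fin m → Bool) : Set where
  field
    to      : Fin n → Fin m
    from    : Fin m → Fin n
    to-∈    : ∀ z → P z ≡ true → Q (to z) ≡ true
    from-∈  : ∀ w → Q w ≡ true → P (from w) ≡ true
    from-to : ∀ z → P z ≡ true → from (to z) ≡ z
    to-from : ∀ w → Q w ≡ true → to (from w) ≡ w

module _ {n} {P : Fin n → Bool} where

  PartialBijection-refl : PartialBijection P P
  PartialBijection-refl = record { to = λ z → z ; from = λ z → z ; to-∈ = λ _ e → e ; from-∈ = λ _ e → e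
                                 ; from-to = λ _ _ → refl ; to-from = λ _ _ → refl }

module _ {n m} {P : Fin n → Bool} {Q : Fin m → Bool} (β : PartialBijection P Q) where
  open PartialBijection β

  PartialBijection-sym : PartialBijection Q P
  PartialBijection-sym = record { to = from ; from = to ; to-∈ = from-∈ ; from-∈ = to-∈
                                ; from-to = to-from ; to-from = from-to }

  PartialBijection-restrict : ∀ {P′ Q′} → P′ ⊆ P → Q′ ⊆ Q →
    (∀ z → P′ z ≡ true → Q′ (to z) ≡ true) → (∀ w → Q′ w ≡ true → P′ (from w) ≡ true) →
    PartialBijection P′ Q′
  PartialBijection-restrict P′⊆P Q′⊆Q to-∈′ from-∈′ = record
    { to = to ; from = from ; to-∈ = to-∈′ ; from-∈ = from-∈′
    ; from-to = λ z e → from-to z (P′⊆P z e) ; to-from = λ w e → to-from w (Q′⊆Q w e) }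

  to-injective : ∀ {z z′} → P z ≡ true → P z′ ≡ true → to z ≡ to z′ → z ≡ z′
  to-injective {z} {z′} pz pz′ eq = trans (sym (from-to z pz)) (trans (cong from eq) (from-to z′ pz′))

  PartialBijection-without : ∀ z → P z ≡ true → PartialBijection (without P z) (without Q (to z))
  PartialBijection-without z pz = PartialBijection-restrict (λ v → ∧-elimˡ (P v)) (λ w → ∧-elimˡ (Q w))
    (λ z′ e → ∧-intro (to-∈ z′ (∧-elimˡ (P z′) e)) (cong not (dec-false (to z′ ≟ to z) λ eq →
       not-¬ (dec-true (z′ ≟ z) (to-injective (∧-elimˡ (P z′) e) pz eq)) (not-injective (∧-elimʳ (P z′) e)))))
    (λ w e → ∧-intro (from-∈ w (∧-elimˡ (Q w) e)) (cong not (dec-false (from w ≟ z) λ eq →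
       not-¬ (dec-true (w ≟ to z) (trans (sym (to-from w (∧-elimˡ (Q w) e))) (cong to eq)))
             (not-injective (∧-elimʳ (Q w) e)))))

  PartialBijection-∧ : (p : Fin n → Bool) (q : Fin m → Bool) →
    (∀ z → P z ≡ true → p z ≡ true → q (to z) ≡ true) →
    (∀ w → Q w ≡ true → q w ≡ true → p (from w) ≡ true) →
    PartialBijection (λ z → P z ∧ p z) (λ w → Q w ∧ q w)
  PartialBijection-∧ p q pq qp = PartialBijection-restrict (λ z → ∧-elimˡ (P z)) (λ w → ∧-elimˡ (Q w))
    (λ z e → ∧-intro (to-∈ z (∧-elimˡ (P z) e)) (pq z (∧-elimˡ (P z) e) (∧-elimʳ (P z) e)))
    (λ w e → ∧-intro (from-∈ w (∧-elimˡ (Q w) e)) (qp w (∧-elimˡ (Q w) e) (∧-elimʳ (Q w) e)))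

PartialBijection-trans : ∀ {n m k} {P : Fin n → Bool} {Q : Fin m → Bool} {R : Fin k → Bool} →
  PartialBijection P Q → PartialBijection Q R → PartialBijection P R
PartialBijection-trans β γ = record
  { to = λ z → γ.to (β.to z) ; from = λ w → β.from (γ.from w)
  ; to-∈ = λ z e → γ.to-∈ _ (β.to-∈ z e) ; from-∈ = λ w e → β.from-∈ _ (γ.from-∈ w e)
  ; from-to = λ z e → trans (cong β.from (γ.from-to _ (β.to-∈ z e))) (β.from-to z e)
  ; to-from = λ w e → trans (cong γ.to (β.to-from _ (γ.from-∈ w e))) (γ.to-from w e) }
  where
  module β = PartialBijection β
  module γ = PartialBijection γ

PartialBijection-empty : ∀ {n m} {P : Fin n → Bool} {Q : Fin m → Bool} →
  (∀ z → P z ≡ false) → (∀ w → Q w ≡ false) →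
  (Fin n → Fin m) → (Fin m → Fin n) → PartialBijection P Q
PartialBijection-empty P∅ Q∅ f g = record
  { to = f ; from = g ; to-∈ = λ z e → ⊥-elim (not-¬ e (P∅ z)) ; from-∈ = λ w e → ⊥-elim (not-¬ e (Q∅ w))
  ; from-to = λ z e → ⊥-elim (not-¬ e (P∅ z)) ; to-from = λ w e → ⊥-elim (not-¬ e (Q∅ w)) }

module _ {n m} {P₁ P₂ : Fin n → Bool} {Q₁ Q₂ : Fin m → Bool}
         (β₁ : PartialBijection P₁ Q₁) (β₂ : PartialBijection P₂ Q₂)
         (P-disjoint : ∀ z → P₂ z ≡ true → P₁ z ≡ false) (Q-disjoint : ∀ w → Q₂ w ≡ true → Q₁ w ≡ false) where
  private
    module β₁ = PartialBijection β₁
    module β₂ = PartialBijection β₂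

  union-to : Fin n → Fin m
  union-to z = if P₁ z then β₁.to z else β₂.to z

  union-from : Fin m → Fin n
  union-from w = if Q₁ w then β₁.from w else β₂.from w

  union-to-cases : ∀ z → (P₁ z ∨ P₂ z) ≡ true →
    (P₁ z ≡ true × union-to z ≡ β₁.to z) ⊎ (P₂ z ≡ true × union-to z ≡ β₂.to z)
  union-to-cases z e with ∨-elim (P₁ z) e
  ... | inj₁ p₁ rewrite p₁ = inj₁ (refl , refl)
  ... | inj₂ p₂ rewrite P-disjoint z p₂ = inj₂ (p₂ , refl)

  union-from-cases : ∀ w → (Q₁ w ∨ Q₂ w) ≡ true →
    (Q₁ w ≡ true × union-from w ≡ β₁.from w) ⊎ (Q₂ w ≡ true × union-from w ≡ β₂.from w)
  union-from-cases w e with ∨-elim (Q₁ w) e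
  ... | inj₁ q₁ rewrite q₁ = inj₁ (refl , refl)
  ... | inj₂ q₂ rewrite Q-disjoint w q₂ = inj₂ (q₂ , refl)

  PartialBijection-union : PartialBijection (λ z → P₁ z ∨ P₂ z) (λ w → Q₁ w ∨ Q₂ w)
  PartialBijection-union = record
    { to = union-to ; from = union-from ; to-∈ = to-∈ ; from-∈ = from-∈ ; from-to = from-to ; to-from = to-from }
    where
    to-∈ : ∀ z → (P₁ z ∨ P₂ z) ≡ true → (Q₁ (union-to z) ∨ Q₂ (union-to z)) ≡ true
    to-∈ z e with union-to-cases z e
    ... | inj₁ (p₁ , eq) rewrite eq = ∨-introˡ _ (β₁.to-∈ z p₁)
    ... | inj₂ (p₂ , eq) rewrite eq = ∨-introʳ (Q₁ (β₂.to z)) (β₂.to-∈ z p₂)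

    from-∈ : ∀ w → (Q₁ w ∨ Q₂ w) ≡ true → (P₁ (union-from w) ∨ P₂ (union-from w)) ≡ true
    from-∈ w e with union-from-cases w e
    ... | inj₁ (q₁ , eq) rewrite eq = ∨-introˡ _ (β₁.from-∈ w q₁)
    ... | inj₂ (q₂ , eq) rewrite eq = ∨-introʳ (P₁ (β₂.from w)) (β₂.from-∈ w q₂)

    from-to : ∀ z → (P₁ z ∨ P₂ z) ≡ true → union-from (union-to z) ≡ z
    from-to z e with union-to-cases z e
    ... | inj₁ (p₁ , eq) rewrite eq with union-from-cases (β₁.to z) (∨-introˡ _ (β₁.to-∈ z p₁))
    ...   | inj₁ (_ , eq′) = trans eq′ (β₁.from-to z p₁)
    ...   | inj₂ (q₂ , _) = ⊥-elim (not-¬ (β₁.to-∈ z p₁) (Q-disjoint _ q₂))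
    from-to z e | inj₂ (p₂ , eq) rewrite eq
      with union-from-cases (β₂.to z) (∨-introʳ (Q₁ (β₂.to z)) (β₂.to-∈ z p₂))
    ...   | inj₁ (q₁ , _) = ⊥-elim (not-¬ q₁ (Q-disjoint _ (β₂.to-∈ z p₂)))
    ...   | inj₂ (_ , eq′) = trans eq′ (β₂.from-to z p₂)

    to-from : ∀ w → (Q₁ w ∨ Q₂ w) ≡ true → union-to (union-from w) ≡ w
    to-from w e with union-from-cases w e
    ... | inj₁ (q₁ , eq) rewrite eq with union-to-cases (β₁.from w) (∨-introˡ _ (β₁.from-∈ w q₁))
    ...   | inj₁ (_ , eq′) = trans eq′ (β₁.to-from w q₁)
    ...   | inj₂ (p₂ , _) = ⊥-elim (not-¬ (β₁.from-∈ w q₁) (P-disjoint _ p₂))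
    to-from w e | inj₂ (q₂ , eq) rewrite eq
      with union-to-cases (β₂.from w) (∨-introʳ (P₁ (β₂.from w)) (β₂.from-∈ w q₂))
    ...   | inj₁ (p₁ , _) = ⊥-elim (not-¬ p₁ (P-disjoint _ (β₂.from-∈ w q₂)))
    ...   | inj₂ (_ , eq′) = trans eq′ (β₂.to-from w q₂)

count-bijection : ∀ {n m} {P : Fin n → Bool} {Q : Fin m → Bool} → PartialBijection P Q → count P ≡ count Q
count-bijection {P = P} = by-size (count P) refl
  where
  by-size : ∀ {n m} c {P : Fin n → Bool} {Q : Fin m → Bool} → count P ≡ c → PartialBijection P Q → c ≡ count Q
  by-size zero {P} {Q} eP β = sym (count-false Q λ w → ¬-not λ q →
    not-¬ (PartialBijection.from-∈ β w q) (count≡0⇒false P eP (PartialBijection.from β w)))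
  by-size (suc c) {P} {Q} eP β with count>0⇒∃ P (subst (1 ≤_) (sym eP) (s≤s z≤n))
  ... | z , pz = trans (cong suc (by-size c cP (PartialBijection-without β z pz)))
                       (sym (count-without Q (to z) (to-∈ z pz)))
    where
    open PartialBijection β
    cP : count (without P z) ≡ c
    cP = suc-injective (trans (sym (count-without P z pz)) eP)

module _ (X : ColGraph) where

  ClosedIn : Vset X → Vset X → Set
  ClosedIn R A = ∀ u w → A u ≡ true → R w ≡ true → adj X u w ≡ true → A w ≡ true

  Reach-endpoints : ∀ {S u w} → Reach X S u w → S u ≡ true × S w ≡ true
  Reach-endpoints (here su)     = su , su
  Reach-endpoints (step r sw _) = proj₁ (Reach-endpoints r) , sw

  Reach-mono : ∀ {S S′ u w} → S ⊆ S′ → Reach X S u w → Reach X S′ u w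
  Reach-mono h (here su)     = here (h _ su)
  Reach-mono h (step r sw a) = step (Reach-mono h r) (h _ sw) a

  Reach-cons : ∀ {S u v w} → S u ≡ true → adj X u v ≡ true → Reach X S v w → Reach X S u w
  Reach-cons su a (here sv)      = step (here su) sv a
  Reach-cons su a (step r sw a′) = step (Reach-cons su a r) sw a′

  Reach-sym : ∀ {S u w} → Reach X S u w → Reach X S w u
  Reach-sym (here su) = here su
  Reach-sym (step {v = v} {w = w} r sw a) = Reach-cons sw (trans (adj-sym X w v) a) (Reach-sym r)

  Reach-trans : ∀ {S u v w} → Reach X S u v → Reach X S v w → Reach X S u w
  Reach-trans r (here _)       = r
  Reach-trans r (step r′ sw a) = step (Reach-trans r r′) sw a

  Reach-first-step : ∀ {S u w} → Reach X S u w →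
    u ≡ w ⊎ ∃ λ v → adj X u v ≡ true × Reach X (without S u) v w
  Reach-first-step (here _) = inj₁ refl
  Reach-first-step {u = u} (step {w = w} r sw a) with Reach-first-step r | w ≟ u
  ... | _                    | yes w≡u = inj₁ (sym w≡u)
  ... | inj₁ refl            | no w≢u  = inj₂ (w , a , here (∧-intro sw (cong not (dec-false (w ≟ u) w≢u))))
  ... | inj₂ (v , a′ , r′)   | no w≢u  =
    inj₂ (v , a′ , step r′ (∧-intro sw (cong not (dec-false (w ≟ u) w≢u))) a)

  Reach-closed : ∀ {R A u w} → Reach X R u w → A u ≡ true → ClosedIn R A → Reach X A u w
  Reach-closed (here _) au cl = here au
  Reach-closed (step r rw a) au cl = step r′ (cl _ _ (proj₂ (Reach-endpoints r′)) rw a) a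
    where r′ = Reach-closed r au cl

  Reach-closed-∈ : ∀ {R A u w} → Reach X R u w → A u ≡ true → ClosedIn R A → A w ≡ true
  Reach-closed-∈ r au cl = proj₂ (Reach-endpoints (Reach-closed r au cl))

  -- Depth-first search that deletes the current vertex before recursing, so |S| levels suffice.
  reachableWithin : ℕ → Vset X → Fin (n X) → Fin (n X) → Bool
  reachableWithin zero    S u w = false
  reachableWithin (suc k) S u w =
    S u ∧ (does (u ≟ w) ∨ anyᵇ (λ v → adj X u v ∧ reachableWithin k (without S u) v w))

  reachableWithin-sound : ∀ k S u w → reachableWithin k S u w ≡ true → Reach X S u w
  reachableWithin-sound (suc k) S u w e with ∨-elim (does (u ≟ w)) (∧-elimʳ (S u) e)
  ... | inj₁ u≟w with dec-true⁻¹ (u ≟ w) u≟w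
  ...   | refl = here (∧-elimˡ (S u) e)
  reachableWithin-sound (suc k) S u w e | inj₂ viaNeighbour with anyᵇ-elim _ viaNeighbour
  ... | v , av = Reach-cons (∧-elimˡ (S u) e) (∧-elimˡ _ av)
                   (Reach-mono (λ x → ∧-elimˡ (S x))
                     (reachableWithin-sound k (without S u) v w (∧-elimʳ (adj X u v) av)))

  reachableWithin-complete : ∀ k S u w → count S ≤ k → Reach X S u w → reachableWithin k S u w ≡ true
  reachableWithin-complete zero S u w |S|≤0 r
    with () ← subst (_≤ 0) (count-without S u (proj₁ (Reach-endpoints r))) |S|≤0
  reachableWithin-complete (suc k) S u w |S|≤k r
    with s≤s |S-u|≤k ← subst (_≤ suc k) (count-without S u (proj₁ (Reach-endpoints r))) |S|≤k
       | Reach-first-step r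
  ... | inj₁ refl = ∧-intro (proj₁ (Reach-endpoints r)) (∨-introˡ _ (≟-refl u))
  ... | inj₂ (v , a , r′) = ∧-intro (proj₁ (Reach-endpoints r)) (∨-introʳ (does (u ≟ w))
          (anyᵇ-intro _ v (∧-intro a (reachableWithin-complete k (without S u) v w |S-u|≤k r′))))

  reachable : Vset X → Fin (n X) → Fin (n X) → Bool
  reachable = reachableWithin (n X)

  reachable⇒Reach : ∀ {S u w} → reachable S u w ≡ true → Reach X S u w
  reachable⇒Reach = reachableWithin-sound (n X) _ _ _

  Reach⇒reachable : ∀ {S u w} → Reach X S u w → reachable S u w ≡ true
  Reach⇒reachable {S} = reachableWithin-complete (n X) S _ _ (count-≤ S)

  component : Vset X → Fin (n X) → Vset X
  component = reachable

  component-⊆ : ∀ R z → component R z ⊆ R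
  component-⊆ R z v e = proj₂ (Reach-endpoints (reachable⇒Reach e))

  component-self : ∀ R z → R z ≡ true → component R z z ≡ true
  component-self R z e = Reach⇒reachable (here e)

  component-closed : ∀ R z → ClosedIn R (component R z)
  component-closed R z u w cu rw a = Reach⇒reachable (step (reachable⇒Reach cu) rw a)

  component-sym : ∀ R z w → component R z w ≡ true → component R w z ≡ true
  component-sym R z w e = Reach⇒reachable (Reach-sym (reachable⇒Reach e))

  component-≐ : ∀ R z w → component R z w ≡ true → component R z ≐ component R w
  component-≐ R z w e v = true-iff
    (λ e′ → Reach⇒reachable (Reach-trans (Reach-sym (reachable⇒Reach e)) (reachable⇒Reach e′)))
    (λ e′ → Reach⇒reachable (Reach-trans (reachable⇒Reach e) (reachable⇒Reach e′)))

  component-⊆-closed : ∀ R A z → A z ≡ true → ClosedIn R A → component R z ⊆ A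
  component-⊆-closed R A z az cl v e = Reach-closed-∈ (reachable⇒Reach e) az cl

  component-connected : ∀ R z → R z ≡ true → Connected X (component R z)
  component-connected R z rz = (z , component-self R z rz) , λ u w cu cw →
    Reach-closed (Reach-trans (Reach-sym (reachable⇒Reach cu)) (reachable⇒Reach cw)) cu
                 (component-closed R z)

  component-isComponent : ∀ R z → R z ≡ true → IsComponent X R (component R z)
  component-isComponent R z rz = component-⊆ R z , component-connected R z rz , component-closed R z

  component-no-edge : ∀ R r z z′ → component R r z ≡ true → R z′ ≡ true → component R r z′ ≡ false →
    adj X z z′ ≡ false
  component-no-edge R r z z′ cz rz′ cz′ = ¬-not λ a → not-¬ (component-closed R r z z′ cz rz′ a) cz′

  ClosedIn-minus-component : ∀ R A r → A ⊆ R → ClosedIn R A →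
    ClosedIn R (λ v → A v ∧ not (component R r v))
  ClosedIn-minus-component R A r A⊆R cl u w au rw a =
    ∧-intro (cl u w (∧-elimˡ (A u) au) rw a) (cong not (¬-not λ cw →
      not-¬ (component-closed R r w u cw (A⊆R u (∧-elimˡ (A u) au)) (trans (adj-sym X w u) a))
            (not-injective (∧-elimʳ (A u) au))))

module _ (X : ColGraph) where

  Connected-cong : ∀ {S S′} → S ≐ S′ → Connected X S → Connected X S′
  Connected-cong eq ((v , sv) , h) = (v , trans (sym (eq v)) sv) , λ u w su sw →
    Reach-mono X (λ x e → trans (sym (eq x)) e) (h u w (trans (eq u) su) (trans (eq w) sw))

  IsComponent-cong : ∀ {S S′ C} → S ≐ S′ → IsComponent X S′ C → IsComponent X S C
  IsComponent-cong eq (C⊆S′ , con , cl) =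
    (λ v e → trans (eq v) (C⊆S′ v e)) , con , λ u w cu sw a → cl u w cu (trans (sym (eq w)) sw) a

  TdLe-cong : ∀ {S S′ d} → S ≐ S′ → TdLe X S d → TdLe X S′ d
  TdLe-cong eq (single |S|≡1 1≤d) = single (trans (sym (count-cong eq)) |S|≡1) 1≤d
  TdLe-cong eq (conn c 1<|S| v sv t) =
    conn (Connected-cong eq c) (subst (1 <_) (count-cong eq) 1<|S|) v (trans (sym (eq v)) sv)
         (TdLe-cong (λ w → cong (λ b → b ∧ not (does (w ≟ v))) (eq w)) t)
  TdLe-cong eq (disc nc h) =
    disc (λ c → nc (Connected-cong (λ v → sym (eq v)) c)) (λ C ic → h C (IsComponent-cong eq ic))

  -- A single vertex or a connected set is its own unique component.
  TdLe-component : ∀ {S C d} → TdLe X S d → IsComponent X S C → TdLe X C d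
  TdLe-component {S} {C} t@(single |S|≡1 _) (C⊆S , ((c , cc) , _) , _) = TdLe-cong S≐C t
    where
    S≐C : S ≐ C
    S≐C v = true-iff (λ sv → subst (λ x → C x ≡ true) (count≡1-unique S |S|≡1 (C⊆S c cc) sv) cc) (C⊆S v)
  TdLe-component {S} {C} t@(conn (_ , path) _ _ _ _) (C⊆S , ((c , cc) , _) , cl) = TdLe-cong S≐C t
    where
    S≐C : S ≐ C
    S≐C w = true-iff (λ sw → Reach-closed-∈ X (path c w (C⊆S c cc) sw) cc cl) (C⊆S w)
  TdLe-component (disc _ h) ic = h _ ic

  TdLe-empty : ∀ {S d} → (∀ v → S v ≡ false) → TdLe X S d
  TdLe-empty h = disc (λ ((v , sv) , _) → not-¬ sv (h v))
                      (λ C (C⊆S , ((c , cc) , _) , _) → ⊥-elim (not-¬ (C⊆S c cc) (h c)))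

  TdLe-root : ∀ {C d} → Connected X C → TdLe X C (suc d) → ∃ λ r → C r ≡ true × TdLe X (remove X C r) d
  TdLe-root {C} ((v , cv) , _) (single |C|≡1 _) = v , cv , TdLe-empty
    (count≡0⇒false (remove X C v) (suc-injective (trans (sym (count-without C v cv)) |C|≡1)))
  TdLe-root _ (conn _ _ v cv t) = v , cv , t
  TdLe-root c (disc nc _) = ⊥-elim (nc c)

  TdLe-connected-zero : ∀ {C} → Connected X C → ¬ TdLe X C 0
  TdLe-connected-zero c (disc nc _) = nc c

-- Isomorphisms between parts of two graphs, over tuples

record SubIso {j} (X : ColGraph) (x̄ : Vector (Fin (n X)) j) (S : Vset X)
                  (Y : ColGraph) (ȳ : Vector (Fin (n Y)) j) (T : Vset Y) : Set where
  field
    bij       : PartialBijection S T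
  open PartialBijection bij public
  field
    adj-to    : ∀ z z′ → S z ≡ true → S z′ ≡ true → adj Y (to z) (to z′) ≡ adj X z z′
    col-to    : ∀ z → S z ≡ true → col Y (to z) ≡ col X z
    tuple-adj : ∀ i z → S z ≡ true → adj Y (ȳ i) (to z) ≡ adj X (x̄ i) z
open SubIso

module _ {j} {X : ColGraph} {x̄ : Vector (Fin (n X)) j} where

  SubIso-refl : ∀ S → SubIso X x̄ S X x̄ S
  SubIso-refl S = record
    { bij = PartialBijection-refl
    ; adj-to = λ _ _ _ _ → refl ; col-to = λ _ _ → refl ; tuple-adj = λ _ _ _ → refl }

module _ {j} {X Y : ColGraph} {x̄ : Vector (Fin (n X)) j} {ȳ : Vector (Fin (n Y)) j} where

  SubIso-sym : ∀ {S T} → SubIso X x̄ S Y ȳ T → SubIso Y ȳ T X x̄ S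
  SubIso-sym φ = record
    { bij = PartialBijection-sym (bij φ)
    ; adj-to = λ w w′ tw tw′ → sym (trans (sym (cong₂ (adj Y) (to-from φ w tw) (to-from φ w′ tw′)))
                                          (adj-to φ _ _ (from-∈ φ w tw) (from-∈ φ w′ tw′)))
    ; col-to = λ w tw → sym (trans (cong (col Y) (sym (to-from φ w tw))) (col-to φ _ (from-∈ φ w tw)))
    ; tuple-adj = λ i w tw → sym (trans (cong (adj Y (ȳ i)) (sym (to-from φ w tw)))
                                        (tuple-adj φ i _ (from-∈ φ w tw))) }

  SubIso-restrict : ∀ {S T S′ T′} (φ : SubIso X x̄ S Y ȳ T) → S′ ⊆ S → T′ ⊆ T →
    (∀ z → S′ z ≡ true → T′ (to φ z) ≡ true) → (∀ w → T′ w ≡ true → S′ (from φ w) ≡ true) →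
    SubIso X x̄ S′ Y ȳ T′
  SubIso-restrict φ S′⊆S T′⊆T to-∈′ from-∈′ = record
    { bij = PartialBijection-restrict (bij φ) S′⊆S T′⊆T to-∈′ from-∈′
    ; adj-to = λ z z′ e e′ → adj-to φ z z′ (S′⊆S z e) (S′⊆S z′ e′)
    ; col-to = λ z e → col-to φ z (S′⊆S z e)
    ; tuple-adj = λ i z e → tuple-adj φ i z (S′⊆S z e) }

  SubIso-cong : ∀ {S T S′ T′} → SubIso X x̄ S Y ȳ T → S ≐ S′ → T ≐ T′ → SubIso X x̄ S′ Y ȳ T′
  SubIso-cong φ S≐S′ T≐T′ = SubIso-restrict φ (λ z e → trans (S≐S′ z) e) (λ w e → trans (T≐T′ w) e)
    (λ z e → trans (sym (T≐T′ _)) (to-∈ φ z (trans (S≐S′ z) e)))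
    (λ w e → trans (sym (S≐S′ _)) (from-∈ φ w (trans (T≐T′ w) e)))

  -- The maps of a SubIso are total, so even the empty one needs functions between the vertex sets.
  SubIso-empty : ∀ {S T} → (∀ z → S z ≡ false) → (∀ w → T w ≡ false) →
    (Fin (n X) → Fin (n Y)) → (Fin (n Y) → Fin (n X)) → SubIso X x̄ S Y ȳ T
  SubIso-empty S∅ T∅ f g = record
    { bij = PartialBijection-empty S∅ T∅ f g
    ; adj-to = λ z _ e _ → ⊥-elim (not-¬ e (S∅ z)) ; col-to = λ z e → ⊥-elim (not-¬ e (S∅ z))
    ; tuple-adj = λ _ z e → ⊥-elim (not-¬ e (S∅ z)) }

  SubIso-count : ∀ {S T} (φ : SubIso X x̄ S Y ȳ T) (p : Vset X) (q : Vset Y) →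
    (∀ z → S z ≡ true → p z ≡ true → q (to φ z) ≡ true) →
    (∀ w → T w ≡ true → q w ≡ true → p (from φ w) ≡ true) →
    count (λ z → S z ∧ p z) ≡ count (λ w → T w ∧ q w)
  SubIso-count φ p q pq qp = count-bijection (PartialBijection-∧ (bij φ) p q pq qp)

module _ {j} {X Y Z : ColGraph} {x̄ : Vector (Fin (n X)) j} {ȳ : Vector (Fin (n Y)) j} {z̄ : Vector (Fin (n Z)) j} where

  SubIso-trans : ∀ {S T U} → SubIso X x̄ S Y ȳ T → SubIso Y ȳ T Z z̄ U → SubIso X x̄ S Z z̄ U
  SubIso-trans φ ψ = record
    { bij = PartialBijection-trans (bij φ) (bij ψ)
    ; adj-to = λ z z′ e e′ → trans (adj-to ψ _ _ (to-∈ φ z e) (to-∈ φ z′ e′)) (adj-to φ z z′ e e′)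
    ; col-to = λ z e → trans (col-to ψ _ (to-∈ φ z e)) (col-to φ z e)
    ; tuple-adj = λ i z e → trans (tuple-adj ψ i _ (to-∈ φ z e)) (tuple-adj φ i z e) }

module _ {j} {X Y : ColGraph} {x̄ : Vector (Fin (n X)) j} {ȳ : Vector (Fin (n Y)) j} {S₁ T₁ S₂ T₂}
         (φ : SubIso X x̄ S₁ Y ȳ T₁) (ψ : SubIso X x̄ S₂ Y ȳ T₂)
         (S-disjoint : ∀ z → S₂ z ≡ true → S₁ z ≡ false)
         (T-disjoint : ∀ w → T₂ w ≡ true → T₁ w ≡ false) where

  SubIso-union : (∀ z z′ → S₁ z ≡ true → S₂ z′ ≡ true → adj Y (to φ z) (to ψ z′) ≡ adj X z z′) →
    SubIso X x̄ (λ z → S₁ z ∨ S₂ z) Y ȳ (λ w → T₁ w ∨ T₂ w)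
  SubIso-union cross = record { bij = β ; adj-to = adj-to′ ; col-to = col-to′ ; tuple-adj = tuple-adj′ }
    where
    β = PartialBijection-union (bij φ) (bij ψ) S-disjoint T-disjoint
    cases = union-to-cases (bij φ) (bij ψ) S-disjoint T-disjoint
    F = PartialBijection.to β

    adj-to′ : ∀ z z′ → (S₁ z ∨ S₂ z) ≡ true → (S₁ z′ ∨ S₂ z′) ≡ true →
              adj Y (F z) (F z′) ≡ adj X z z′
    adj-to′ z z′ e e′ with cases z e | cases z′ e′
    ... | inj₁ (s , Fz) | inj₁ (s′ , Fz′) rewrite Fz | Fz′ = adj-to φ z z′ s s′
    ... | inj₁ (s , Fz) | inj₂ (s′ , Fz′) rewrite Fz | Fz′ = cross z z′ s s′
    ... | inj₂ (s , Fz) | inj₁ (s′ , Fz′) rewrite Fz | Fz′ =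
      trans (adj-sym Y _ _) (trans (cross z′ z s′ s) (adj-sym X _ _))
    ... | inj₂ (s , Fz) | inj₂ (s′ , Fz′) rewrite Fz | Fz′ = adj-to ψ z z′ s s′

    col-to′ : ∀ z → (S₁ z ∨ S₂ z) ≡ true → col Y (F z) ≡ col X z
    col-to′ z e with cases z e
    ... | inj₁ (s , Fz) rewrite Fz = col-to φ z s
    ... | inj₂ (s , Fz) rewrite Fz = col-to ψ z s

    tuple-adj′ : ∀ i z → (S₁ z ∨ S₂ z) ≡ true → adj Y (ȳ i) (F z) ≡ adj X (x̄ i) z
    tuple-adj′ i z e with cases z e
    ... | inj₁ (s , Fz) rewrite Fz = tuple-adj φ i z s
    ... | inj₂ (s , Fz) rewrite Fz = tuple-adj ψ i z s

SubIso-tail : ∀ {j X Y} {x̄ : Vector (Fin (n X)) (suc j)} {ȳ : Vector (Fin (n Y)) (suc j)} {S T} →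
  SubIso X x̄ S Y ȳ T → SubIso X (tail x̄) S Y (tail ȳ) T
SubIso-tail φ = record { bij = bij φ ; adj-to = adj-to φ ; col-to = col-to φ ; tuple-adj = λ i → tuple-adj φ (fs i) }

SubIso-cons : ∀ {j X Y} {x̄ : Vector (Fin (n X)) j} {ȳ : Vector (Fin (n Y)) j} {S T} (φ : SubIso X x̄ S Y ȳ T) r y →
  (∀ z → S z ≡ true → adj Y y (to φ z) ≡ adj X r z) → SubIso X (r ∷ x̄) S Y (y ∷ ȳ) T
SubIso-cons φ r y adj-y = record
  { bij = bij φ ; adj-to = adj-to φ ; col-to = col-to φ
  ; tuple-adj = λ { fz z s → adj-y z s ; (fs i) z s → tuple-adj φ i z s } }

SubIso-remove-point : ∀ {j X Y} {x̄ : Vector (Fin (n X)) j} {ȳ : Vector (Fin (n Y)) j} {A B} r y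
  (φ : SubIso X x̄ (λ v → does (v ≟ r) ∨ A v) Y ȳ (λ w → does (w ≟ y) ∨ B w)) → to φ r ≡ y →
  (∀ v → A v ≡ true → does (v ≟ r) ≡ false) → (∀ w → B w ≡ true → does (w ≟ y) ≡ false) →
  SubIso X x̄ A Y ȳ B
SubIso-remove-point {A = A} {B} r y φ φr≡y A∌r B∌y =
  SubIso-restrict φ (λ v → ∨-introʳ (does (v ≟ r))) (λ w → ∨-introʳ (does (w ≟ y))) to-∈′ from-∈′
  where
  r∈ : (does (r ≟ r) ∨ A r) ≡ true
  r∈ = ∨-introˡ (A r) (≟-refl r)
  to-∈′ : ∀ v → A v ≡ true → B (to φ v) ≡ true
  to-∈′ v av with ∨-elim (does (to φ v ≟ y)) (to-∈ φ v (∨-introʳ (does (v ≟ r)) av))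
  ... | inj₂ b = b
  ... | inj₁ φv≟y = ⊥-elim (not-¬ (dec-true (v ≟ r) v≡r) (A∌r v av))
    where
    v≡r = to-injective (bij φ) (∨-introʳ (does (v ≟ r)) av) r∈
                       (trans (dec-true⁻¹ (to φ v ≟ y) φv≟y) (sym φr≡y))
  from-∈′ : ∀ w → B w ≡ true → A (from φ w) ≡ true
  from-∈′ w bw with ∨-elim (does (from φ w ≟ r)) (from-∈ φ w (∨-introʳ (does (w ≟ y)) bw))
  ... | inj₂ a = a
  ... | inj₁ φw≟r = ⊥-elim (not-¬ (dec-true (w ≟ y) w≡y) (B∌y w bw))
    where
    w≡y = trans (sym (to-from φ w (∨-introʳ (does (w ≟ y)) bw)))
                (trans (cong (to φ) (dec-true⁻¹ (from φ w ≟ r) φw≟r)) φr≡y)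

UnionOfComponents : (X : ColGraph) → Vset X → Vset X → Set
UnionOfComponents X R S = S ⊆ R × ClosedIn X R S

SubIso-Reach : ∀ {j X Y} {x̄ : Vector (Fin (n X)) j} {ȳ : Vector (Fin (n Y)) j} {S T R R′}
  (φ : SubIso X x̄ S Y ȳ T) → ClosedIn X R S → T ⊆ R′ →
  ∀ {u v} → Reach X R u v → S u ≡ true → Reach Y R′ (to φ u) (to φ v)
SubIso-Reach φ S-closed T⊆R′ (here _) su = here (T⊆R′ _ (to-∈ φ _ su))
SubIso-Reach φ S-closed T⊆R′ (step {v = v} {w = w} r rw a) su =
  step (SubIso-Reach φ S-closed T⊆R′ r su) (T⊆R′ _ (to-∈ φ w sw)) (trans (adj-to φ v w sv sw) a)
  where
  sv = Reach-closed-∈ _ r su S-closed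
  sw = S-closed v w sv rw a

module _ {j} {X Y : ColGraph} {x̄ : Vector (Fin (n X)) j} {ȳ : Vector (Fin (n Y)) j} {S T R R′}
         (φ : SubIso X x̄ S Y ȳ T) (S-union : UnionOfComponents X R S) (T-union : UnionOfComponents Y R′ T) where

  SubIso-component : ∀ w → S w ≡ true → SubIso X x̄ (component X R w) Y ȳ (component Y R′ (to φ w))
  SubIso-component w sw = SubIso-restrict φ
    (component-⊆-closed X R S w sw (proj₂ S-union))
    (component-⊆-closed Y R′ T (to φ w) (to-∈ φ w sw) (proj₂ T-union))
    (λ v e → Reach⇒reachable Y (SubIso-Reach φ (proj₂ S-union) (proj₁ T-union) (reachable⇒Reach X e) sw))
    (λ v e → subst (λ u → component X R u (from φ v) ≡ true) (from-to φ w sw)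
       (Reach⇒reachable X (SubIso-Reach (SubIso-sym φ) (proj₂ T-union) (proj₁ S-union) (reachable⇒Reach Y e)
                                       (to-∈ φ w sw))))

-- The part of a graph below a tuple of roots

module Tuples (X : ColGraph) where

  outside : ∀ {j} → Vector (Fin (n X)) j → Vset X
  outside x̄ y = allᵇ (λ i → not (does (y ≟ x̄ i)))

  marked : ∀ {j} → Vector (Fin (n X)) j → Vset X
  marked {zero}  x̄ y = true
  marked {suc j} x̄ y = adj X (x̄ fz) y

  -- The union of the components of X − x̄ containing a neighbour of the newest entry x̄ 0 (all of
  -- X − x̄ for the empty tuple): for a chain of roots in a tree-depth decomposition, the part of the
  -- graph hanging below the last root.
  below : ∀ {j} → Vector (Fin (n X)) j → Vset X
  below x̄ w = anyᵇ (λ m → marked x̄ m ∧ component X (outside x̄) m w)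

  module _ {j} (x̄ : Vector (Fin (n X)) j) where

    below-⊆-outside : below x̄ ⊆ outside x̄
    below-⊆-outside w e with anyᵇ-elim _ e
    ... | m , q = component-⊆ X (outside x̄) m w (∧-elimʳ (marked x̄ m) q)

    below-closed : ClosedIn X (outside x̄) (below x̄)
    below-closed u w bu ow a with anyᵇ-elim _ bu
    ... | m , q = anyᵇ-intro _ m (∧-intro (∧-elimˡ _ q)
                    (component-closed X (outside x̄) m u w (∧-elimʳ (marked x̄ m) q) ow a))

    marked-below : ∀ y → outside x̄ y ≡ true → marked x̄ y ≡ true → below x̄ y ≡ true
    marked-below y oy my = anyᵇ-intro _ y (∧-intro my (component-self X (outside x̄) y oy))

    below⇒marked : ∀ w → below x̄ w ≡ true → ∃ λ m → marked x̄ m ≡ true × Reach X (outside x̄) w m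
    below⇒marked w e with anyᵇ-elim _ e
    ... | m , q = m , ∧-elimˡ _ q , Reach-sym X (reachable⇒Reach X (∧-elimʳ (marked x̄ m) q))

    component-⊆-below : ∀ z → below x̄ z ≡ true → component X (outside x̄) z ⊆ below x̄
    component-⊆-below z bz = component-⊆-closed X (outside x̄) (below x̄) z bz below-closed

  module _ {j} (x̄ : Vector (Fin (n X)) j) (r : Fin (n X)) where

    outside-∷ : outside (r ∷ x̄) ≐ without (outside x̄) r
    outside-∷ w = ∧-comm (not (does (w ≟ r))) (outside x̄ w)

    outside-∷-⊆ : outside (r ∷ x̄) ⊆ outside x̄
    outside-∷-⊆ w e = ∧-elimˡ (outside x̄ w) (trans (sym (outside-∷ w)) e)

    below-∷-≢ : ∀ v → below (r ∷ x̄) v ≡ true → does (v ≟ r) ≡ false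
    below-∷-≢ v e = not-injective (∧-elimˡ _ (below-⊆-outside (r ∷ x̄) v e))

    component-root-split : outside x̄ r ≡ true → ∀ v →
      component X (outside x̄) r v ≡ (does (v ≟ r) ∨ below (r ∷ x̄) v)
    component-root-split r∉x̄ v = true-iff split⇒ split⇐
      where
      split⇒ : component X (outside x̄) r v ≡ true → (does (v ≟ r) ∨ below (r ∷ x̄) v) ≡ true
      split⇒ e with v ≟ r | Reach-first-step X (reachable⇒Reach X e)
      ... | yes _  | _ = refl
      ... | no v≢r | inj₁ r≡v = ⊥-elim (v≢r (sym r≡v))
      ... | no _   | inj₂ (m , a , r′) = anyᵇ-intro _ m
              (∧-intro a (Reach⇒reachable X (Reach-mono X (λ w e → trans (outside-∷ w) e) r′)))
      split⇐ : (does (v ≟ r) ∨ below (r ∷ x̄) v) ≡ true → component X (outside x̄) r v ≡ true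
      split⇐ e with ∨-elim (does (v ≟ r)) e
      ... | inj₁ v≟r rewrite dec-true⁻¹ (v ≟ r) v≟r = component-self X (outside x̄) r r∉x̄
      ... | inj₂ bv with anyᵇ-elim _ bv
      ...   | m , q = Reach⇒reachable X (Reach-cons X r∉x̄ (∧-elimˡ _ q)
                        (Reach-mono X outside-∷-⊆ (reachable⇒Reach X (∧-elimʳ (adj X r m) q))))

    below-∷-⊆-component : outside x̄ r ≡ true → below (r ∷ x̄) ⊆ component X (outside x̄) r
    below-∷-⊆-component r∉x̄ v e =
      trans (component-root-split r∉x̄ v) (∨-introʳ (does (v ≟ r)) e)

  below-[] : ∀ y → below [] y ≡ true
  below-[] y = marked-below [] y refl refl

  PartOfBelow : ∀ {j} → Vector (Fin (n X)) j → Vset X → Set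
  PartOfBelow x̄ S = S ⊆ below x̄ × ClosedIn X (outside x̄) S

  module _ {j} (x̄ : Vector (Fin (n X)) j) where

    PartOfBelow-⊆-outside : ∀ {S} → PartOfBelow x̄ S → S ⊆ outside x̄
    PartOfBelow-⊆-outside (S⊆below , _) v e = below-⊆-outside x̄ v (S⊆below v e)

    PartOfBelow⇒UnionOfComponents : ∀ {S} → PartOfBelow x̄ S → UnionOfComponents X (outside x̄) S
    PartOfBelow⇒UnionOfComponents S-part = PartOfBelow-⊆-outside S-part , proj₂ S-part

    below-PartOfBelow : PartOfBelow x̄ (below x̄)
    below-PartOfBelow = (λ _ e → e) , below-closed x̄

    component-PartOfBelow : ∀ z → below x̄ z ≡ true → PartOfBelow x̄ (component X (outside x̄) z)
    component-PartOfBelow z bz = component-⊆-below x̄ z bz , component-closed X (outside x̄) z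

    PartOfBelow-minus-component : ∀ {S} r → PartOfBelow x̄ S →
      PartOfBelow x̄ (λ v → S v ∧ not (component X (outside x̄) r v))
    PartOfBelow-minus-component {S} r S-part@(S⊆below , S-closed) =
      (λ v e → S⊆below v (∧-elimˡ (S v) e)) ,
      ClosedIn-minus-component X (outside x̄) S r (PartOfBelow-⊆-outside S-part) S-closed

    -- Every component of X − x̄ inside below x̄ contains a marked vertex.
    PartOfBelow-unmarked-empty : ∀ {T} → PartOfBelow x̄ T → count (λ y → T y ∧ marked x̄ y) ≡ 0 →
      ∀ w → T w ≡ false
    PartOfBelow-unmarked-empty {T} (T⊆below , T-closed) none w = ¬-not λ tw →
      let m , mm , w⇝m = below⇒marked x̄ w (T⊆below w tw)
      in not-¬ (∧-intro (Reach-closed-∈ X w⇝m tw T-closed) mm)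
               (count≡0⇒false (λ y → T y ∧ marked x̄ y) none m)

  BelowTd≤ : ∀ {j} → ℕ → Vector (Fin (n X)) j → Set
  BelowTd≤ d x̄ = ∀ z → below x̄ z ≡ true → TdLe X (component X (outside x̄) z) d

  record RootChoice {j} (d : ℕ) (x̄ : Vector (Fin (n X)) j) (z : Fin (n X)) : Set where
    field
      root   : Fin (n X)
      root∈  : component X (outside x̄) z root ≡ true
      below≤ : BelowTd≤ d (root ∷ x̄)
  open RootChoice public

  BelowTd≤-[] : ∀ {d} → TreeDepth≤ X d → BelowTd≤ d []
  BelowTd≤-[] t z _ = TdLe-component X t (component-isComponent X (outside []) z refl)

  BelowTd≤-zero : ∀ {j} (x̄ : Vector (Fin (n X)) j) → BelowTd≤ 0 x̄ → ∀ z → below x̄ z ≡ false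
  BelowTd≤-zero x̄ h z = ¬-not λ bz →
    TdLe-connected-zero X (component-connected X (outside x̄) z (below-⊆-outside x̄ z bz)) (h z bz)

  BelowTd≤-root : ∀ {j d} (x̄ : Vector (Fin (n X)) j) → BelowTd≤ (suc d) x̄ →
    ∀ z → below x̄ z ≡ true → RootChoice d x̄ z
  BelowTd≤-root {d = d} x̄ h z bz
    with r , cr , t ← TdLe-root X (component-connected X (outside x̄) z (below-⊆-outside x̄ z bz)) (h z bz) =
    record { root = r ; root∈ = cr ; below≤ = λ w bw → TdLe-component X t (isComponent w bw) }
    where
    C = component X (outside x̄) z
    r∉x̄ : outside x̄ r ≡ true
    r∉x̄ = component-⊆ X (outside x̄) z r cr
    C-r⊆outside : remove X C r ⊆ outside (r ∷ x̄)
    C-r⊆outside v e = trans (outside-∷ x̄ r v)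
      (∧-intro (component-⊆ X (outside x̄) z v (∧-elimˡ (C v) e)) (∧-elimʳ (C v) e))
    isComponent : ∀ w → below (r ∷ x̄) w ≡ true → IsComponent X (remove X C r) (component X (outside (r ∷ x̄)) w)
    isComponent w bw = C′⊆C-r , component-connected X _ w (below-⊆-outside (r ∷ x̄) w bw) ,
                       λ u v cu sv a → component-closed X _ w u v cu (C-r⊆outside v sv) a
      where
      C′⊆C-r : component X (outside (r ∷ x̄)) w ⊆ remove X C r
      C′⊆C-r v e = ∧-intro
        (trans (component-≐ X (outside x̄) z r cr v)
               (Reach⇒reachable X (Reach-trans X (reachable⇒Reach X (below-∷-⊆-component x̄ r r∉x̄ w bw))
                 (Reach-mono X (outside-∷-⊆ x̄ r) (reachable⇒Reach X e)))))
        (∧-elimˡ _ (component-⊆ X _ w v e))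

marked-transport : ∀ {j X Y} {x̄ : Vector (Fin (n X)) j} {ȳ : Vector (Fin (n Y)) j} {S T}
  (φ : SubIso X x̄ S Y ȳ T) w → S w ≡ true → Tuples.marked Y ȳ (to φ w) ≡ Tuples.marked X x̄ w
marked-transport {zero}  φ w sw = refl
marked-transport {suc j} φ w sw = tuple-adj φ fz w sw

SubIso-count-marked : ∀ {j X Y} {x̄ : Vector (Fin (n X)) j} {ȳ : Vector (Fin (n Y)) j} {S T} (φ : SubIso X x̄ S Y ȳ T) →
  count (λ v → S v ∧ Tuples.marked X x̄ v) ≡ count (λ w → T w ∧ Tuples.marked Y ȳ w)
SubIso-count-marked φ = SubIso-count φ _ _ (λ v sv m → trans (marked-transport φ v sv) m)
                                           (λ w tw m → trans (marked-transport (SubIso-sym φ) w tw) m)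

-- The (total) maps required by SubIso-empty: a tuple entry if there is one, otherwise the two
-- graphs have equally many (all marked) vertices.
fallback-maps : ∀ {j X Y} (x̄ : Vector (Fin (n X)) j) (ȳ : Vector (Fin (n Y)) j) →
  count (λ v → Tuples.below X x̄ v ∧ Tuples.marked X x̄ v) ≡
  count (λ w → Tuples.below Y ȳ w ∧ Tuples.marked Y ȳ w) →
  (Fin (n X) → Fin (n Y)) × (Fin (n Y) → Fin (n X))
fallback-maps {suc j} x̄ ȳ _ = (λ _ → ȳ fz) , (λ _ → x̄ fz)
fallback-maps {zero} {X} {Y} x̄ ȳ e = subst Fin nX≡nY , subst Fin (sym nX≡nY)
  where
  all-marked : ∀ Z (z̄ : Vector (Fin (n Z)) 0) → count (λ v → Tuples.below Z z̄ v ∧ true) ≡ n Z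
  all-marked Z z̄ = trans (count-cong λ v → trans (∧-identityʳ _) (Tuples.below-[] Z v)) (count-true (n Z))
  nX≡nY : n X ≡ n Y
  nX≡nY = trans (sym (all-marked X x̄)) (trans e (all-marked Y ȳ))

-- Counting formulas in de Bruijn form, and their compilation into C^(0,k)

data Form : ℕ → Set where
  Edge Equal : ∀ {j} → Fin j → Fin j → Form j
  Colour     : ∀ {j} → ℕ → Fin j → Form j
  Not        : ∀ {j} → Form j → Form j
  And        : ∀ {j} → Form j → Form j → Form j
  AtLeast    : ∀ {j} → ℕ → Form (suc j) → Form j

sem : (X : ColGraph) → ∀ {j} → Vector (Fin (n X)) j → Form j → Bool
sem X x̄ (Edge i i′)    = adj X (x̄ i) (x̄ i′)
sem X x̄ (Equal i i′)   = does (x̄ i ≟ x̄ i′)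
sem X x̄ (Colour c i)   = does (col X (x̄ i) ℕ.≟ c)
sem X x̄ (Not φ)        = not (sem X x̄ φ)
sem X x̄ (And φ ψ)      = sem X x̄ φ ∧ sem X x̄ ψ
sem X x̄ (AtLeast m φ)  = m ≤ᵇ count (λ v → sem X (v ∷ x̄) φ)

depth : ∀ {j} → Form j → ℕ
depth (Edge _ _)    = 0
depth (Equal _ _)   = 0
depth (Colour _ _)  = 0
depth (Not φ)       = depth φ
depth (And φ ψ)     = depth φ ⊔ depth ψ
depth (AtLeast _ φ) = suc (depth φ)

-- A quantifier under nx others binds the variable y_nx, so a formula of depth ≤ k never requantifies.
-- (var m is m mod k, which is y_m itself whenever the depth bound is respected.)
module Compile (k : ℕ) .{{_ : NonZero k}} where

  var : ℕ → Fin k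
  var m = m mod k

  toℕ-var : ∀ {m} → m < k → toℕ (var m) ≡ m
  toℕ-var {m} m<k = trans (toℕ-fromℕ< (m%n<n m k)) (m<n⇒m%n≡m m<k)

  compile : ∀ {j} → Form j → Vector (Fin k) j → ℕ → Formula k
  compile (Edge i i′)   ρ nx = edge (ρ i) (ρ i′)
  compile (Equal i i′)  ρ nx = eqᶠ (ρ i) (ρ i′)
  compile (Colour c i)  ρ nx = color c (ρ i)
  compile (Not φ)       ρ nx = neg (compile φ ρ nx)
  compile (And φ ψ)     ρ nx = and (compile φ ρ nx) (compile ψ ρ nx)
  compile (AtLeast m φ) ρ nx = quant (∃≥ m) (var nx) (compile φ (var nx ∷ ρ) (suc nx))

  VarsBelow : ∀ {j} → Vector (Fin k) j → ℕ → Set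
  VarsBelow ρ nx = ∀ i → toℕ (ρ i) < nx

  private
    bound-andˡ : ∀ nx a b → nx + (a ⊔ b) ≤ k → nx + a ≤ k
    bound-andˡ nx a b = ≤-trans (+-monoʳ-≤ nx (m≤m⊔n a b))
    bound-andʳ : ∀ nx a b → nx + (a ⊔ b) ≤ k → nx + b ≤ k
    bound-andʳ nx a b = ≤-trans (+-monoʳ-≤ nx (m≤n⊔m a b))
    bound-body : ∀ nx a → nx + suc a ≤ k → suc nx + a ≤ k
    bound-body nx a = subst (_≤ k) (+-suc nx a)
    bound-var : ∀ nx a → nx + suc a ≤ k → nx < k
    bound-var nx a b = ≤-trans (s≤s (m≤m+n nx a)) (bound-body nx a b)

  VarsBelow-∷ : ∀ {j} (ρ : Vector (Fin k) j) nx → nx < k → VarsBelow ρ nx → VarsBelow (var nx ∷ ρ) (suc nx)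
  VarsBelow-∷ ρ nx nx<k ρ<nx fz     = s≤s (≤-reflexive (toℕ-var nx<k))
  VarsBelow-∷ ρ nx nx<k ρ<nx (fs i) = ≤-trans (ρ<nx i) (n≤1+n nx)

  eval-compile : ∀ X {j} (φ : Form j) ρ nx (a : Assign X) (x̄ : Vector (Fin (n X)) j) →
    nx + depth φ ≤ k → VarsBelow ρ nx → (∀ i → a (ρ i) ≡ just (x̄ i)) →
    eval X (compile φ ρ nx) a ≡ sem X x̄ φ
  eval-compile X (Edge i i′)   ρ nx a x̄ b ρ<nx a≈x̄ rewrite a≈x̄ i | a≈x̄ i′ = refl
  eval-compile X (Equal i i′)  ρ nx a x̄ b ρ<nx a≈x̄ rewrite a≈x̄ i | a≈x̄ i′ = refl
  eval-compile X (Colour c i)  ρ nx a x̄ b ρ<nx a≈x̄ rewrite a≈x̄ i = refl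
  eval-compile X (Not φ)       ρ nx a x̄ b ρ<nx a≈x̄ = cong not (eval-compile X φ ρ nx a x̄ b ρ<nx a≈x̄)
  eval-compile X (And φ ψ)     ρ nx a x̄ b ρ<nx a≈x̄ =
    cong₂ _∧_ (eval-compile X φ ρ nx a x̄ (bound-andˡ nx _ _ b) ρ<nx a≈x̄)
              (eval-compile X ψ ρ nx a x̄ (bound-andʳ nx _ _ b) ρ<nx a≈x̄)
  eval-compile X (AtLeast m φ) ρ nx a x̄ b ρ<nx a≈x̄ = cong (m ≤ᵇ_) (count-cong λ v →
    eval-compile X φ (var nx ∷ ρ) (suc nx) (update X a (var nx) v) (v ∷ x̄)
                 (bound-body nx _ b) (VarsBelow-∷ ρ nx nx<k ρ<nx) (updated v))
    where
    nx<k = bound-var nx _ b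
    updated : ∀ v i → update X a (var nx) v ((var nx ∷ ρ) i) ≡ just ((v ∷ x̄) i)
    updated v fz rewrite ≟-refl (var nx) = refl
    updated v (fs i) rewrite dec-false (ρ i ≟ var nx)
      (λ ρi≡ → <-irrefl (toℕ-var nx<k) (subst (λ y → toℕ y < nx) ρi≡ (ρ<nx i))) = a≈x̄ i

  isBound-compile : ∀ {j} (φ : Form j) ρ nx x → nx + depth φ ≤ k →
    isBound x (compile φ ρ nx) ≡ true → nx ≤ toℕ x
  isBound-compile (Not φ) ρ nx x b e = isBound-compile φ ρ nx x b e
  isBound-compile (And φ ψ) ρ nx x b e with ∨-elim (isBound x (compile φ ρ nx)) e
  ... | inj₁ e′ = isBound-compile φ ρ nx x (bound-andˡ nx _ _ b) e′
  ... | inj₂ e′ = isBound-compile ψ ρ nx x (bound-andʳ nx _ _ b) e′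
  isBound-compile (AtLeast m φ) ρ nx x b e with ∨-elim (does (x ≟ var nx)) e
  ... | inj₁ x≟ rewrite dec-true⁻¹ (x ≟ var nx) x≟ = ≤-reflexive (sym (toℕ-var (bound-var nx _ b)))
  ... | inj₂ e′ = ≤-trans (n≤1+n nx) (isBound-compile φ _ (suc nx) x (bound-body nx _ b) e′)

  isFree-compile : ∀ {j} (φ : Form j) ρ nx x → nx + depth φ ≤ k → VarsBelow ρ nx →
    isFree x (compile φ ρ nx) ≡ true → toℕ x < nx
  isFree-compile (Edge i i′) ρ nx x b ρ<nx e with ∨-elim (does (x ≟ ρ i)) e
  ... | inj₁ x≟ rewrite dec-true⁻¹ (x ≟ ρ i) x≟ = ρ<nx i
  ... | inj₂ x≟ rewrite dec-true⁻¹ (x ≟ ρ i′) x≟ = ρ<nx i′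
  isFree-compile (Equal i i′) ρ nx x b ρ<nx e with ∨-elim (does (x ≟ ρ i)) e
  ... | inj₁ x≟ rewrite dec-true⁻¹ (x ≟ ρ i) x≟ = ρ<nx i
  ... | inj₂ x≟ rewrite dec-true⁻¹ (x ≟ ρ i′) x≟ = ρ<nx i′
  isFree-compile (Colour c i) ρ nx x b ρ<nx e rewrite dec-true⁻¹ (x ≟ ρ i) e = ρ<nx i
  isFree-compile (Not φ) ρ nx x b ρ<nx e = isFree-compile φ ρ nx x b ρ<nx e
  isFree-compile (And φ ψ) ρ nx x b ρ<nx e with ∨-elim (isFree x (compile φ ρ nx)) e
  ... | inj₁ e′ = isFree-compile φ ρ nx x (bound-andˡ nx _ _ b) ρ<nx e′
  ... | inj₂ e′ = isFree-compile ψ ρ nx x (bound-andʳ nx _ _ b) ρ<nx e′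
  isFree-compile (AtLeast m φ) ρ nx x b ρ<nx e = ≤∧≢⇒< (≤-pred x<1+nx) x≢nx
    where
    nx<k = bound-var nx _ b
    x<1+nx : toℕ x < suc nx
    x<1+nx = isFree-compile φ _ (suc nx) x (bound-body nx _ b) (VarsBelow-∷ ρ nx nx<k ρ<nx)
                            (∧-elimʳ (not (does (x ≟ var nx))) e)
    x≢nx : toℕ x ≢ nx
    x≢nx x≡nx = not-¬ (dec-true (x ≟ var nx) (toℕ-injective (trans x≡nx (sym (toℕ-var nx<k)))))
                      (not-injective (∧-elimˡ _ e))

  compile-no-requantification : ∀ {j} (φ : Form j) ρ nx {Q x ψ} → nx + depth φ ≤ k →
    Sub (quant Q x ψ) (compile φ ρ nx) → isBound x ψ ≡ true → ⊥
  compile-no-requantification (Not φ) ρ nx b (sub-neg s) = compile-no-requantification φ ρ nx b s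
  compile-no-requantification (And φ ψ) ρ nx b (sub-andˡ s) =
    compile-no-requantification φ ρ nx (bound-andˡ nx _ _ b) s
  compile-no-requantification (And φ ψ) ρ nx b (sub-andʳ s) =
    compile-no-requantification ψ ρ nx (bound-andʳ nx _ _ b) s
  compile-no-requantification (AtLeast m φ) ρ nx b sub-refl bd =
    n≮n nx (≤-trans (isBound-compile φ _ (suc nx) (var nx) (bound-body nx _ b) bd)
                    (≤-reflexive (toℕ-var (bound-var nx _ b))))
  compile-no-requantification (AtLeast m φ) ρ nx b (sub-q s) =
    compile-no-requantification φ _ (suc nx) (bound-body nx _ b) s

  compile-InC0 : ∀ {j} (φ : Form j) ρ nx → nx + depth φ ≤ k → VarsBelow ρ nx → InC0 k (compile φ ρ nx)
  compile-InC0 φ ρ nx b ρ<nx x (inj₁ (free , bound)) =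
    <-irrefl refl (≤-trans (isFree-compile φ ρ nx x b ρ<nx free) (isBound-compile φ ρ nx x b bound))
  compile-InC0 φ ρ nx b ρ<nx x (inj₂ (_ , _ , s , bound)) = compile-no-requantification φ ρ nx b s bound

  compile-Sentence : ∀ (φ : Form 0) → depth φ ≤ k → Sentence (compile φ [] 0)
  compile-Sentence φ b x = ¬-not λ free → case isFree-compile φ [] 0 x b (λ ()) free of λ ()

⋀ : ∀ {j m} → (Fin m → Form j) → Form j → Form j
⋀ {m = zero}  φ ψ = ψ
⋀ {m = suc m} φ ψ = And (φ fz) (⋀ (λ i → φ (fs i)) ψ)

Exactly : ∀ {j} → ℕ → Form (suc j) → Form j
Exactly c φ = And (AtLeast c φ) (Not (AtLeast (suc c) φ))

Fresh : ∀ {j} → Form (suc j)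
Fresh = ⋀ (λ i → Not (Equal fz (fs i))) (Equal fz fz)

Marked : ∀ {j} → Form (suc j)
Marked {zero}  = Fresh
Marked {suc j} = And (Edge (fs fz) fz) Fresh

depth-⋀ : ∀ {j m} (φ : Fin m → Form j) ψ k → (∀ i → depth (φ i) ≤ k) → depth ψ ≤ k → depth (⋀ φ ψ) ≤ k
depth-⋀ {m = zero}  φ ψ k φ≤k ψ≤k = ψ≤k
depth-⋀ {m = suc m} φ ψ k φ≤k ψ≤k =
  ⊔-lub (φ≤k fz) (depth-⋀ (λ i → φ (fs i)) ψ k (λ i → φ≤k (fs i)) ψ≤k)

depth-Exactly : ∀ {j} c (φ : Form (suc j)) k → depth φ ≤ k → depth (Exactly c φ) ≤ suc k
depth-Exactly c φ k φ≤k = ⊔-lub (s≤s φ≤k) (s≤s φ≤k)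

depth-Fresh : ∀ {j} k → depth (Fresh {j}) ≤ k
depth-Fresh {j} k = depth-⋀ {j = suc j} {m = j} (λ i → Not (Equal fz (fs i))) (Equal fz fz) k (λ _ → z≤n) z≤n

depth-Marked : ∀ {j} k → depth (Marked {j}) ≤ k
depth-Marked {zero}  k = depth-Fresh {0} k
depth-Marked {suc j} k = ⊔-lub z≤n (depth-Fresh {suc j} k)

module _ (X : ColGraph) where
  open Tuples X

  sem-⋀ : ∀ {j m} (x̄ : Vector (Fin (n X)) j) (φ : Fin m → Form j) ψ →
    sem X x̄ (⋀ φ ψ) ≡ (allᵇ (λ i → sem X x̄ (φ i)) ∧ sem X x̄ ψ)
  sem-⋀ {m = zero}  x̄ φ ψ = refl
  sem-⋀ {m = suc m} x̄ φ ψ = trans (cong (sem X x̄ (φ fz) ∧_) (sem-⋀ x̄ (λ i → φ (fs i)) ψ))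
                                   (sym (∧-assoc (sem X x̄ (φ fz)) _ _))

  sem-Exactly⁻ : ∀ {j} (x̄ : Vector (Fin (n X)) j) c φ → sem X x̄ (Exactly c φ) ≡ true →
    count (λ v → sem X (v ∷ x̄) φ) ≡ c
  sem-Exactly⁻ x̄ c φ = exactly⇒≡ c _

  sem-Exactly⁺ : ∀ {j} (x̄ : Vector (Fin (n X)) j) c φ → count (λ v → sem X (v ∷ x̄) φ) ≡ c →
    sem X x̄ (Exactly c φ) ≡ true
  sem-Exactly⁺ x̄ c φ e rewrite e = exactly-refl c

  sem-Fresh : ∀ {j} (x̄ : Vector (Fin (n X)) j) y → sem X (y ∷ x̄) Fresh ≡ outside x̄ y
  sem-Fresh x̄ y = trans (sem-⋀ (y ∷ x̄) (λ i → Not (Equal fz (fs i))) (Equal fz fz))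
                        (trans (cong (outside x̄ y ∧_) (≟-refl y)) (∧-identityʳ _))

  sem-Marked : ∀ {j} (x̄ : Vector (Fin (n X)) j) y → sem X (y ∷ x̄) Marked ≡ (marked x̄ y ∧ outside x̄ y)
  sem-Marked {zero}  x̄ y = sem-Fresh x̄ y
  sem-Marked {suc j} x̄ y = cong (adj X (x̄ fz) y ∧_) (sem-Fresh x̄ y)

  count-Marked : ∀ {j} (x̄ : Vector (Fin (n X)) j) →
    count (λ y → sem X (y ∷ x̄) Marked) ≡ count (λ y → below x̄ y ∧ marked x̄ y)
  count-Marked x̄ = count-cong λ y → trans (sem-Marked x̄ y) (true-iff
    (λ e → ∧-intro (marked-below x̄ y (∧-elimʳ (marked x̄ y) e) (∧-elimˡ _ e)) (∧-elimˡ _ e))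
    (λ e → ∧-intro (∧-elimʳ (below x̄ y) e) (below-⊆-outside x̄ y (∧-elimˡ _ e))))

module _ (G : ColGraph) {j} (ā : Vector (Fin (n G)) j) (r : Fin (n G)) where

  AdjacencyTo : Fin j → Form (suc j)
  AdjacencyTo i = if adj G (ā i) r then Edge (fs i) fz else Not (Edge (fs i) fz)

  DistinctAdjacency : Fin j → Form (suc j)
  DistinctAdjacency i = And (Not (Equal fz (fs i))) (AdjacencyTo i)

  AtomType : Form (suc j)
  AtomType = ⋀ DistinctAdjacency (Colour (col G r) fz)

  depth-AtomType : ∀ k → depth AtomType ≤ k
  depth-AtomType k = depth-⋀ _ _ k (λ i → ⊔-lub z≤n (depth-AdjacencyTo i)) z≤n
    where
    depth-AdjacencyTo : ∀ i → depth (AdjacencyTo i) ≤ k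
    depth-AdjacencyTo i with adj G (ā i) r
    ... | true  = z≤n
    ... | false = z≤n

  module _ (X : ColGraph) (x̄ : Vector (Fin (n X)) j) (y : Fin (n X)) where
    open Tuples X

    AtomTypeOf : Set
    AtomTypeOf = outside x̄ y ≡ true × (∀ i → adj X (x̄ i) y ≡ adj G (ā i) r) × col X y ≡ col G r

    sem-AdjacencyTo : ∀ i → sem X (y ∷ x̄) (AdjacencyTo i) ≡ true ⇔ adj X (x̄ i) y ≡ adj G (ā i) r
    sem-AdjacencyTo i with adj G (ā i) r
    ... | true  = mk⇔ (λ e → e) (λ e → e)
    ... | false = mk⇔ not-injective (cong not)

    sem-AtomType⁻ : sem X (y ∷ x̄) AtomType ≡ true → AtomTypeOf
    sem-AtomType⁻ e = allᵇ-intro _ (λ i → ∧-elimˡ _ (each i)) ,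
                      (λ i → Equivalence.to (sem-AdjacencyTo i) (∧-elimʳ (not (does (y ≟ x̄ i))) (each i))) ,
                      ≡ᵇ⇒≡ _ _ (≡true⇒T (∧-elimʳ (allᵇ P) e′))
      where
      P : Fin j → Bool
      P i = sem X (y ∷ x̄) (DistinctAdjacency i)
      e′ = trans (sym (sem-⋀ X (y ∷ x̄) DistinctAdjacency (Colour (col G r) fz))) e
      each = allᵇ-elim P (∧-elimˡ (allᵇ P) e′)

    sem-AtomType⁺ : AtomTypeOf → sem X (y ∷ x̄) AtomType ≡ true
    sem-AtomType⁺ (y∉x̄ , adj≡ , col≡) = trans (sem-⋀ X (y ∷ x̄) DistinctAdjacency (Colour (col G r) fz)) (∧-intro
      (allᵇ-intro (λ i → sem X (y ∷ x̄) (DistinctAdjacency i)) λ i →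
         ∧-intro (allᵇ-elim _ y∉x̄ i) (Equivalence.from (sem-AdjacencyTo i) (adj≡ i)))
      (dec-true (col X y ℕ.≟ col G r) col≡))

    SubIso-singleton : AtomTypeOf → SubIso G ā (λ v → does (v ≟ r)) X x̄ (λ w → does (w ≟ y))
    SubIso-singleton (_ , adj≡ , col≡) = record
      { bij = record { to = λ _ → y ; from = λ _ → r ; to-∈ = λ _ _ → ≟-refl y ; from-∈ = λ _ _ → ≟-refl r
                     ; from-to = λ v e → sym (dec-true⁻¹ (v ≟ r) e) ; to-from = λ w e → sym (dec-true⁻¹ (w ≟ y) e) }
      ; adj-to = λ v v′ e e′ → adj-point (dec-true⁻¹ (v ≟ r) e) (dec-true⁻¹ (v′ ≟ r) e′)
      ; col-to = λ v e → col-point (dec-true⁻¹ (v ≟ r) e)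
      ; tuple-adj = λ i v e → tuple-point i (dec-true⁻¹ (v ≟ r) e) }
      where
      adj-point : ∀ {v v′} → v ≡ r → v′ ≡ r → adj X y y ≡ adj G v v′
      adj-point refl refl = trans (irrefl X y) (sym (irrefl G r))
      col-point : ∀ {v} → v ≡ r → col X y ≡ col G v
      col-point refl = col≡
      tuple-point : ∀ i {v} → v ≡ r → adj X (x̄ i) y ≡ adj G (ā i) v
      tuple-point i refl = adj≡ i

-- Characteristic formulas

module Characteristic (G : ColGraph) where
  open Tuples G
  private
    module T = Tuples

  ExactlyMarked : ∀ {j} → Vector (Fin (n G)) j → Form j
  ExactlyMarked ā = Exactly (count (λ y → sem G (y ∷ ā) Marked)) Marked

  mutual
    χ : ∀ d {j} (ā : Vector (Fin (n G)) j) → BelowTd≤ d ā → Form j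
    χ zero    ā _ = ExactlyMarked ā
    χ (suc d) ā h = ⋀ (λ z → Clause d ā h z (below ā z) refl) (ExactlyMarked ā)

    RootType : ∀ d {j} {ā : Vector (Fin (n G)) j} {z} → RootChoice d ā z → Form (suc j)
    RootType d {ā = ā} c = And (AtomType G ā (root c)) (χ d (root c ∷ ā) (below≤ c))

    -- Only vertices of below ā contribute; the others get a harmless filler.
    Clause : ∀ d {j} (ā : Vector (Fin (n G)) j) → BelowTd≤ (suc d) ā → ∀ z b → below ā z ≡ b → Form j
    Clause d ā h z true  e = Exactly (count (λ y → sem G (y ∷ ā) θ)) θ
      where θ = RootType d (BelowTd≤-root ā h z e)
    Clause d ā h z false _ = ExactlyMarked ā

  depth-ExactlyMarked : ∀ {j} (ā : Vector (Fin (n G)) j) k → depth (ExactlyMarked ā) ≤ suc k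
  depth-ExactlyMarked {j} ā k = depth-Exactly {j} (count (λ y → sem G (y ∷ ā) Marked)) Marked k (depth-Marked {j} k)

  mutual
    depth-χ : ∀ d {j} (ā : Vector (Fin (n G)) j) h → depth (χ d ā h) ≤ suc d
    depth-χ zero    ā h = depth-ExactlyMarked ā 0
    depth-χ (suc d) ā h = depth-⋀ (λ z → Clause d ā h z (below ā z) refl) (ExactlyMarked ā) (suc (suc d))
                                  (λ z → depth-Clause d ā h z (below ā z) refl) (depth-ExactlyMarked ā (suc d))

    depth-Clause : ∀ d {j} (ā : Vector (Fin (n G)) j) h z b (e : below ā z ≡ b) →
      depth (Clause d ā h z b e) ≤ suc (suc d)
    depth-Clause d ā h z true  e = depth-Exactly (count (λ y → sem G (y ∷ ā) (RootType d c))) (RootType d c) (suc d)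
      (⊔-lub (depth-AtomType G ā (root c) (suc d)) (depth-χ d (root c ∷ ā) (below≤ c)))
      where c = BelowTd≤-root ā h z e
    depth-Clause d ā h z false e = depth-ExactlyMarked ā (suc d)

  χ-Sound χ-Complete : ∀ d {j} (ā : Vector (Fin (n G)) j) → BelowTd≤ d ā → Set
  χ-Sound d {j} ā h =
    ∀ Z (z̄ : Vector (Fin (n Z)) j) → sem Z z̄ (χ d ā h) ≡ true → SubIso G ā (below ā) Z z̄ (T.below Z z̄)
  χ-Complete d {j} ā h =
    ∀ Z (z̄ : Vector (Fin (n Z)) j) → SubIso G ā (below ā) Z z̄ (T.below Z z̄) → sem Z z̄ (χ d ā h) ≡ true

  RootIso : ∀ {j} → Vector (Fin (n G)) j → Fin (n G) → (Z : ColGraph) → Vector (Fin (n Z)) j → Fin (n Z) → Set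
  RootIso ā r Z z̄ y =
    Σ (SubIso G ā (component G (outside ā) r) Z z̄ (component Z (T.outside Z z̄) y)) λ φ → to φ r ≡ y

  RootIso-below : ∀ {j} {ā : Vector (Fin (n G)) j} {r Z} {z̄ : Vector (Fin (n Z)) j} {y} →
    below ā r ≡ true → RootIso ā r Z z̄ y → T.below Z z̄ y ≡ true
  RootIso-below {ā = ā} {r} {Z} {z̄} {y} br (α , _) with below⇒marked ā r br
  ... | m , mm , r⇝m = anyᵇ-intro _ (to α m)
          (∧-intro (trans (marked-transport α m cm) mm) (component-sym Z _ y (to α m) (to-∈ α m cm)))
    where
    cm : component G (outside ā) r m ≡ true
    cm = Reach⇒reachable G r⇝m

  module _ {d j} {ā : Vector (Fin (n G)) j} {z} (c : RootChoice d ā z) (r∉ā : outside ā (root c) ≡ true) where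
    private
      r = root c
      r∈C = component-self G (outside ā) r r∉ā

    RootType-sound :
      χ-Sound d (r ∷ ā) (below≤ c) →
      ∀ Z z̄ y → sem Z (y ∷ z̄) (RootType d c) ≡ true → T.outside Z z̄ y ≡ true × RootIso ā r Z z̄ y
    RootType-sound sound Z z̄ y s =
      y∉z̄ ,
      SubIso-cong glued (λ v → sym (component-root-split ā r r∉ā v))
                        (λ w → sym (T.component-root-split Z z̄ y y∉z̄ w)) ,
      cong (λ b → if b then y else to φ r) (≟-refl r)
      where
      atom = sem-AtomType⁻ G ā r Z z̄ y (∧-elimˡ _ s)
      y∉z̄ = proj₁ atom
      φ = sound Z (y ∷ z̄) (∧-elimʳ (sem Z (y ∷ z̄) (AtomType G ā r)) s)
      cross : ∀ v v′ → does (v ≟ r) ≡ true → below (r ∷ ā) v′ ≡ true → adj Z y (to φ v′) ≡ adj G v v′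
      cross v v′ v≟r bv′ rewrite dec-true⁻¹ (v ≟ r) v≟r = tuple-adj φ fz v′ bv′
      glued = SubIso-union (SubIso-singleton G ā r Z z̄ y atom) (SubIso-tail φ)
                (λ v bv → below-∷-≢ ā r v bv) (λ w bw → T.below-∷-≢ Z z̄ y w bw) cross

    RootType-complete :
      χ-Complete d (r ∷ ā) (below≤ c) →
      ∀ Z z̄ y → T.outside Z z̄ y ≡ true → RootIso ā r Z z̄ y → sem Z (y ∷ z̄) (RootType d c) ≡ true
    RootType-complete complete Z z̄ y y∉z̄ (ψ , ψr≡y) =
      ∧-intro (sem-AtomType⁺ G ā r Z z̄ y atom) (complete Z (y ∷ z̄) φ)
      where
      atom : AtomTypeOf G ā r Z z̄ y
      atom = y∉z̄ , (λ i → subst (λ q → adj Z (z̄ i) q ≡ adj G (ā i) r) ψr≡y (tuple-adj ψ i r r∈C)) ,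
             subst (λ q → col Z q ≡ col G r) ψr≡y (col-to ψ r r∈C)
      ψ-below = SubIso-remove-point r y
        (SubIso-cong ψ (component-root-split ā r r∉ā) (T.component-root-split Z z̄ y y∉z̄)) ψr≡y
        (below-∷-≢ ā r) (T.below-∷-≢ Z z̄ y)
      φ = SubIso-cons ψ-below r y λ v bv →
        trans (cong (λ q → adj Z q (to ψ v)) (sym ψr≡y)) (adj-to ψ r v r∈C (below-∷-⊆-component ā r r∉ā v bv))

  -- Lets the matching argument below stand apart from the mutual recursion of χ-sound and χ-complete.
  record RootTypes {j} (ā : Vector (Fin (n G)) j) : Set where
    field
      rootOf          : ∀ z → below ā z ≡ true → Fin (n G)
      rootOf∈         : ∀ z e → component G (outside ā) z (rootOf z e) ≡ true
      typeOf          : ∀ z → below ā z ≡ true → Form (suc j)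
      typeOf-sound    : ∀ z e Z z̄ y → sem Z (y ∷ z̄) (typeOf z e) ≡ true →
                        T.outside Z z̄ y ≡ true × RootIso ā (rootOf z e) Z z̄ y
      typeOf-complete : ∀ z e Z z̄ y → T.outside Z z̄ y ≡ true → RootIso ā (rootOf z e) Z z̄ y →
                        sem Z (y ∷ z̄) (typeOf z e) ≡ true

  module _ {j} {ā : Vector (Fin (n G)) j} (τ : RootTypes ā) where
    open RootTypes τ

    typeOf-below : ∀ z e Z z̄ y → sem Z (y ∷ z̄) (typeOf z e) ≡ true → T.below Z z̄ y ≡ true
    typeOf-below z e Z z̄ y s =
      RootIso-below (component-⊆-below ā z e _ (rootOf∈ z e)) (proj₂ (typeOf-sound z e Z z̄ y s))

    typeOf-transport : ∀ {Z W} {z̄ : Vector (Fin (n Z)) j} {w̄ : Vector (Fin (n W)) j} {S U}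
      (φ : SubIso Z z̄ S W w̄ U) → T.PartOfBelow Z z̄ S → T.PartOfBelow W w̄ U →
      ∀ z e v → S v ≡ true → sem Z (v ∷ z̄) (typeOf z e) ≡ true → sem W (to φ v ∷ w̄) (typeOf z e) ≡ true
    typeOf-transport {Z} {W} {z̄} {w̄} φ S-part U-part z e v sv s with typeOf-sound z e Z z̄ v s
    ... | _ , α , αr≡v = typeOf-complete z e W w̄ (to φ v)
            (T.PartOfBelow-⊆-outside W w̄ U-part _ (to-∈ φ v sv))
            (SubIso-trans α β , cong (to φ) αr≡v)
      where
      β = SubIso-component φ (T.PartOfBelow⇒UnionOfComponents Z z̄ S-part)
                             (T.PartOfBelow⇒UnionOfComponents W w̄ U-part) v sv

    module _ (X : ColGraph) (x̄ : Vector (Fin (n X)) j) where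
      private
        module TX = Tuples X

      Balanced : Vset G → Vset X → Set
      Balanced S U =
        (∀ z e → count (λ y → S y ∧ sem G (y ∷ ā) (typeOf z e)) ≡
                 count (λ y → U y ∧ sem X (y ∷ x̄) (typeOf z e)))
        × count (λ y → S y ∧ marked ā y) ≡ count (λ y → U y ∧ TX.marked x̄ y)

      Balanced-SubIso : ∀ {S U} (ψ : SubIso G ā S X x̄ U) → PartOfBelow ā S → TX.PartOfBelow x̄ U → Balanced S U
      Balanced-SubIso ψ S-part U-part =
        (λ z e → SubIso-count ψ _ _ (typeOf-transport ψ S-part U-part z e)
                                    (typeOf-transport (SubIso-sym ψ) U-part S-part z e)) ,
        SubIso-count-marked ψ

      Balanced-minus : ∀ {S U C C′} → C ⊆ S → C′ ⊆ U → Balanced S U → Balanced C C′ →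
        Balanced (λ v → S v ∧ not (C v)) (λ w → U w ∧ not (C′ w))
      Balanced-minus {S} {U} {C} {C′} C⊆S C′⊆U (types , marks) (typesC , marksC) =
        (λ z e → count-minus-cancel S C _ U C′ _ C⊆S C′⊆U (types z e) (typesC z e)) ,
        count-minus-cancel S C _ U C′ _ C⊆S C′⊆U marks marksC

      -- The root of the component of z is of its own type, so by balance U contains a vertex of that type.
      matching-component : ∀ {S U} → PartOfBelow ā S → Balanced S U → ∀ z → S z ≡ true →
        ∃ λ r → ∃ λ y → S r ≡ true × U y ≡ true ×
          SubIso G ā (component G (outside ā) r) X x̄ (component X (TX.outside x̄) y)
      matching-component {S} {U} (S⊆below , S-closed) (types , _) z sz =
        r , y , r∈S , ∧-elimˡ (U y) uy∧θy , proj₁ (proj₂ (typeOf-sound z e X x̄ y (∧-elimʳ (U y) uy∧θy)))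
        where
        e = S⊆below z sz
        r = rootOf z e
        r∈S = component-⊆-closed G (outside ā) S z sz S-closed r (rootOf∈ z e)
        r-type : sem G (r ∷ ā) (typeOf z e) ≡ true
        r-type = typeOf-complete z e G ā r (below-⊆-outside ā r (S⊆below r r∈S)) (SubIso-refl _ , refl)
        1≤#type : 1 ≤ count (λ y → S y ∧ sem G (y ∷ ā) (typeOf z e))
        1≤#type = subst (1 ≤_) (sym (count-without _ r (∧-intro r∈S r-type))) (s≤s z≤n)
        found = count>0⇒∃ (λ y → U y ∧ sem X (y ∷ x̄) (typeOf z e)) (subst (1 ≤_) (types z e) 1≤#type)
        y = proj₁ found
        uy∧θy = proj₂ found

      match-empty : ∀ {S U} → (∀ v → S v ≡ false) → TX.PartOfBelow x̄ U → Balanced S U →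
        (Fin (n G) → Fin (n X)) × (Fin (n X) → Fin (n G)) → SubIso G ā S X x̄ U
      match-empty S∅ U-part (_ , marks) (f , g) = SubIso-empty S∅ U∅ f g
        where
        U∅ = TX.PartOfBelow-unmarked-empty x̄ U-part
               (trans (sym marks) (count-false _ λ y → cong (_∧ marked ā y) (S∅ y)))

      -- Peel off matching components one at a time; k bounds the size of S.
      match : (Fin (n G) → Fin (n X)) × (Fin (n X) → Fin (n G)) →
        ∀ k {S U} → count S ≤ k → PartOfBelow ā S → TX.PartOfBelow x̄ U → Balanced S U → SubIso G ā S X x̄ U
      match fg zero {S} |S|≤0 _ U-part bal = match-empty (count≡0⇒false S (n≤0⇒n≡0 |S|≤0)) U-part bal fg
      match fg (suc k) {S} {U} |S|≤k S-part U-part bal with any? (λ v → T? (S v))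
      ... | no S∌ = match-empty (λ v → ¬-not λ sv → S∌ (v , ≡true⇒T sv)) U-part bal fg
      ... | yes (z , sz) with r , y , r∈S , y∈U , ψ ← matching-component S-part bal z (T⇒≡true sz) =
        SubIso-cong glued (split-⊆ S C C⊆S) (split-⊆ U C′ C′⊆U)
        where
        C  = component G (outside ā) r
        C′ = component X (TX.outside x̄) y
        r∈C = component-self G _ r (PartOfBelow-⊆-outside ā S-part r r∈S)
        C⊆S = component-⊆-closed G _ S r r∈S (proj₂ S-part)
        C′⊆U = component-⊆-closed X _ U y y∈U (proj₂ U-part)
        rest = match fg k (≤-pred (≤-trans (count-minus-< S C r r∈S r∈C) |S|≤k))
                 (PartOfBelow-minus-component ā r S-part) (TX.PartOfBelow-minus-component x̄ y U-part)
                 (Balanced-minus C⊆S C′⊆U bal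
                   (Balanced-SubIso ψ (component-PartOfBelow ā r (proj₁ S-part r r∈S))
                                      (TX.component-PartOfBelow x̄ y (proj₁ U-part y y∈U))))
        cross : ∀ v v′ → C v ≡ true → (S v′ ∧ not (C v′)) ≡ true →
                adj X (to ψ v) (to rest v′) ≡ adj G v v′
        cross v v′ cv sv′ = trans
          (component-no-edge X _ y _ _ (to-∈ ψ v cv) (TX.PartOfBelow-⊆-outside x̄ U-part _ (∧-elimˡ (U _) u′))
                             (not-injective (∧-elimʳ (U _) u′)))
          (sym (component-no-edge G _ r v v′ cv (PartOfBelow-⊆-outside ā S-part v′ (∧-elimˡ (S v′) sv′))
                                  (not-injective (∧-elimʳ (S v′) sv′))))
          where u′ = to-∈ rest v′ sv′
        glued = SubIso-union ψ rest (λ v e → not-injective (∧-elimʳ (S v) e))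
                                    (λ w e → not-injective (∧-elimʳ (U w) e)) cross

  ExactlyMarked-count : ∀ {j} (ā : Vector (Fin (n G)) j) Z (z̄ : Vector (Fin (n Z)) j) →
    sem Z z̄ (ExactlyMarked ā) ≡ true →
    count (λ y → below ā y ∧ marked ā y) ≡ count (λ y → T.below Z z̄ y ∧ T.marked Z z̄ y)
  ExactlyMarked-count ā Z z̄ s =
    trans (sym (count-Marked G ā)) (trans (sym (sem-Exactly⁻ Z z̄ _ Marked s)) (count-Marked Z z̄))

  ExactlyMarked-holds : ∀ {j} (ā : Vector (Fin (n G)) j) Z (z̄ : Vector (Fin (n Z)) j) →
    count (λ y → below ā y ∧ marked ā y) ≡ count (λ y → T.below Z z̄ y ∧ T.marked Z z̄ y) →
    sem Z z̄ (ExactlyMarked ā) ≡ true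
  ExactlyMarked-holds ā Z z̄ marks =
    sem-Exactly⁺ Z z̄ _ Marked (trans (count-Marked Z z̄) (trans (sym marks) (sym (count-Marked G ā))))

  Clause-count : ∀ d {j} (ā : Vector (Fin (n G)) j) h Z (z̄ : Vector (Fin (n Z)) j) z b (e : below ā z ≡ b) →
    sem Z z̄ (Clause d ā h z b e) ≡ true → (e′ : below ā z ≡ true) →
    count (λ y → sem Z (y ∷ z̄) (RootType d (BelowTd≤-root ā h z e′))) ≡
    count (λ y → sem G (y ∷ ā) (RootType d (BelowTd≤-root ā h z e′)))
  Clause-count d ā h Z z̄ z true  e s e′ rewrite Decidable⇒UIP.≡-irrelevant _≟ᵇ_ e e′ =
    sem-Exactly⁻ Z z̄ (count (λ y → sem G (y ∷ ā) θ)) θ s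
    where θ = RootType d (BelowTd≤-root ā h z e′)
  Clause-count d ā h Z z̄ z false e s e′ = ⊥-elim (not-¬ e′ e)

  rootTypes : ∀ d {j} (ā : Vector (Fin (n G)) j) (h : BelowTd≤ (suc d) ā) →
    (∀ z e → χ-Sound d _ (below≤ (BelowTd≤-root ā h z e))) →
    (∀ z e → χ-Complete d _ (below≤ (BelowTd≤-root ā h z e))) →
    RootTypes ā
  rootTypes d ā h sound complete = record
    { rootOf          = λ z e → root (BelowTd≤-root ā h z e)
    ; rootOf∈         = λ z e → root∈ (BelowTd≤-root ā h z e)
    ; typeOf          = λ z e → RootType d (BelowTd≤-root ā h z e)
    ; typeOf-sound    = λ z e → RootType-sound (BelowTd≤-root ā h z e) (r∉ā z e) (sound z e)
    ; typeOf-complete = λ z e → RootType-complete (BelowTd≤-root ā h z e) (r∉ā z e) (complete z e) }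
    where
    r∉ā : ∀ z e → outside ā (root (BelowTd≤-root ā h z e)) ≡ true
    r∉ā z e = component-⊆ G (outside ā) z _ (root∈ (BelowTd≤-root ā h z e))

  mutual
    χ-sound : ∀ d {j} (ā : Vector (Fin (n G)) j) h → χ-Sound d ā h
    χ-sound zero ā h Z z̄ s = SubIso-empty (BelowTd≤-zero ā h) below∅ (proj₁ fg) (proj₂ fg)
      where
      marks = ExactlyMarked-count ā Z z̄ s
      fg = fallback-maps ā z̄ marks
      below∅ = T.PartOfBelow-unmarked-empty Z z̄ (T.below-PartOfBelow Z z̄)
                 (trans (sym marks) (count-false _ λ y → cong (_∧ marked ā y) (BelowTd≤-zero ā h y)))
    χ-sound (suc d) ā h Z z̄ s =
      match τ Z z̄ (fallback-maps ā z̄ marks) (n G) (count-≤ _) (below-PartOfBelow ā) (T.below-PartOfBelow Z z̄)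
            (types , marks)
      where
      τ = rootTypes d ā h (λ z e → χ-sound d _ _) (λ z e → χ-complete d _ _)
      clauses = λ z → sem Z z̄ (Clause d ā h z (below ā z) refl)
      s′ = trans (sym (sem-⋀ Z z̄ (λ z → Clause d ā h z (below ā z) refl) (ExactlyMarked ā))) s
      marks = ExactlyMarked-count ā Z z̄ (∧-elimʳ (allᵇ clauses) s′)
      types : ∀ z e → count (λ y → below ā y ∧ sem G (y ∷ ā) (RootType d (BelowTd≤-root ā h z e))) ≡
                      count (λ y → T.below Z z̄ y ∧ sem Z (y ∷ z̄) (RootType d (BelowTd≤-root ā h z e)))
      types z e = trans (count-∧-⊆ _ _ (typeOf-below τ z e G ā))
        (trans (sym (Clause-count d ā h Z z̄ z (below ā z) refl (allᵇ-elim clauses (∧-elimˡ (allᵇ clauses) s′) z) e))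
               (sym (count-∧-⊆ _ _ (typeOf-below τ z e Z z̄))))

    χ-complete : ∀ d {j} (ā : Vector (Fin (n G)) j) h → χ-Complete d ā h
    χ-complete zero ā h Z z̄ Φ = ExactlyMarked-holds ā Z z̄ (SubIso-count-marked Φ)
    χ-complete (suc d) ā h Z z̄ Φ = trans (sem-⋀ Z z̄ (λ z → Clause d ā h z (below ā z) refl) (ExactlyMarked ā))
      (∧-intro (allᵇ-intro _ λ z → clause-holds z (below ā z) refl) (ExactlyMarked-holds ā Z z̄ (SubIso-count-marked Φ)))
      where
      τ = rootTypes d ā h (λ z e → χ-sound d _ _) (λ z e → χ-complete d _ _)
      types = proj₁ (Balanced-SubIso τ Z z̄ Φ (below-PartOfBelow ā) (T.below-PartOfBelow Z z̄))
      clause-holds : ∀ z b (e : below ā z ≡ b) → sem Z z̄ (Clause d ā h z b e) ≡ true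
      clause-holds z true  e = sem-Exactly⁺ Z z̄ (count (λ y → sem G (y ∷ ā) θ)) θ
        (trans (sym (count-∧-⊆ _ _ (typeOf-below τ z e Z z̄)))
               (trans (sym (types z e)) (count-∧-⊆ _ _ (typeOf-below τ z e G ā))))
        where θ = RootType d (BelowTd≤-root ā h z e)
      clause-holds z false e = ExactlyMarked-holds ā Z z̄ (SubIso-count-marked Φ)

SubIso⇒Iso : ∀ {j G H} {ā : Vector (Fin (n G)) j} {b̄ : Vector (Fin (n H)) j} {S T} → SubIso G ā S H b̄ T →
  (∀ v → S v ≡ true) → (∀ w → T w ≡ true) → Iso G H
SubIso⇒Iso φ all-S all-T = record
  { bij      = mk↔ₛ′ (to φ) (from φ) (λ w → to-from φ w (all-T w)) (λ v → from-to φ v (all-S v))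
  ; pres-adj = λ u v → adj-to φ u v (all-S u) (all-S v)
  ; pres-col = λ v → col-to φ v (all-S v) }

theorem30 : (d : ℕ) → 1 ≤ d → (G : ColGraph) → TreeDepth≤ G d →
    (H : ColGraph) → ¬ Iso G H →
    Σ (Formula (suc d)) (λ φ → InC0 (suc d) φ × Sentence φ ×
    ((G ⊨ φ × ¬ (H ⊨ φ)) ⊎ (¬ (G ⊨ φ) × H ⊨ φ)))
theorem30 d _ G td H G≇H =
  compile χ₀ [] 0 , compile-InC0 χ₀ [] 0 depth≤ (λ ()) , compile-Sentence χ₀ depth≤ , inj₁ (G⊨ , H⊭)
  where
  open Characteristic G
  open Compile (suc d)
  h = Tuples.BelowTd≤-[] G td
  χ₀ = χ d [] h
  depth≤ = depth-χ d [] h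
  eval≡sem : ∀ X → eval X (compile χ₀ [] 0) (λ _ → nothing) ≡ sem X [] χ₀
  eval≡sem X = eval-compile X χ₀ [] 0 (λ _ → nothing) [] depth≤ (λ ()) (λ ())
  G⊨ = trans (eval≡sem G) (χ-complete d [] h G [] (SubIso-refl _))
  H⊭ = λ H⊨ → G≇H (SubIso⇒Iso (χ-sound d [] h H [] (trans (sym (eval≡sem H)) H⊨))
                              (Tuples.below-[] G) (Tuples.below-[] H))
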